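{- Let $p<q$ be positive integers with $\gcd(p,q)=1$, and write $C_{\frac pq}=a_1,\ldots,a_{2(q-1)}$. 1. If $p$ and $q$ are odd, then $\{a_{q-1},a_q\}=\{1,2\}$. 2. If $p$ is even and $q$ is odd, then $\{a_{q-1},a_q\}=\{4,5\}$. 3. If $p$ is odd, $q$ is even and $2p<q$, then $\{a_{q-1},a_q\}=\{2,3\}$. 4. If $p$ is odd, $q$ is even and $2p>q$, then $\{a_{q-1},a_q\}=\{3,4\}$.
   Context: Lattice. Use the lattice of unit segments on the lines $y=c$, $x=c$, $y=-x+c$ ($c\in\mathbb Z$). Sign sequence $\mathbf f(\tfrac pq)$. Let $\gamma$ be the segment from $(0,0)$ to $(q,p)$, oriented away from the origin, crossing lattice segments $\sigma_1,\ldots,\sigma_N$ ($N=2(p+q)-3$) in order at points $s_i$. Then $\mathbf f(\tfrac pq)=(f_0,\ldots,f_{2N})$ is defined as follows. - $f_0=-$ and $f_{2N}=+$. - $f_{2i-1}=-$ if $s_i$ is closer to the endpoint of $\sigma_i$ to the right of $\gamma$, and $+$ if closer to the left one. The middle crossing $i=p+q-1$ is at a midpoint and may receive either sign. - $f_{2i}=-$ if the common endpoint of $\sigma_i,\sigma_{i+1}$ is to the right of $\gamma$, and $+$ otherwise. $C_{\frac pq}$ is the sequence of lengths of the maximal blocks of consecutive equal signs of $\mathbf f(\tfrac pq)$, for a choice of middle sign. It has length $2(q-1)$, and the two choices of middle sign only swap $a_{q-1}$ and $a_q$. -}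

module Defs where

open import Data.Nat.Base using (ℕ; zero; suc; _+_; _*_; _∸_; _<ᵇ_; _≡ᵇ_; _%_; _/_)
open import Data.Bool.Base using (Bool; true; false; if_then_else_; _∧_)
open import Data.Maybe.Base using (Maybe; just; nothing)
open import Data.List.Base using (List; []; _∷_; map; upTo; mapMaybe)
open import Data.Product.Base using (_×_; _,_)

-- Total division / remainder (the divisor is positive wherever they are used).
_%'_ : ℕ → ℕ → ℕ
m %' zero  = m
m %' suc n = m % suc n

_/'_ : ℕ → ℕ → ℕ
m /' zero  = zero
m /' suc n = m / suc n

data Sign : Set where
  minus plus : Sign

_=ˢ_ : Sign → Sign → Bool
minus =ˢ minus = true
plus  =ˢ plus  = true
_     =ˢ _     = false

-- Where the crossing point s_i lies on σ_i.
data Near : Set where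
  nearRight nearLeft midpoint : Near

Point : Set
Point = ℕ × ℕ

-- A crossing of γ with a lattice segment σ: the endpoint of σ to the
-- right of γ, the endpoint to the left of γ, and where s lies on σ.
record Crossing : Set where
  constructor crossing
  field
    rightEnd : Point
    leftEnd  : Point
    near     : Near
open Crossing public

-- r / m is the fractional position of s along σ, measured from the
-- endpoint `lowEnd`; near lowEnd iff 2r < m.
nearFrom : (lowIsRight : Bool) → ℕ → ℕ → Near
nearFrom lowIsRight r m =
  if 2 * r <ᵇ m then (if lowIsRight then nearRight else nearLeft)
  else if m <ᵇ 2 * r then (if lowIsRight then nearLeft else nearRight)
  else midpoint

-- γ : t ↦ (t q, t p), t ∈ (0,1).  Use the integer time T = t·p·q·(p+q).
-- Line x = c   is crossed at T = c·p·(p+q);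
-- line y = c   is crossed at T = c·q·(p+q);
-- line x+y = c is crossed at T = c·p·q.
-- Vertical crossing x = c : σ from (c,⌊pc/q⌋) (right of γ) to (c,⌊pc/q⌋+1) (left).
vertical : ℕ → ℕ → ℕ → Crossing
vertical p q c =
  let y0 = (p * c) /' q ; r = (p * c) %' q in
  crossing (c , y0) (c , suc y0) (nearFrom true r q)

-- Horizontal crossing y = c : σ from (⌊qc/p⌋,c) (left of γ) to (⌊qc/p⌋+1,c) (right).
horizontal : ℕ → ℕ → ℕ → Crossing
horizontal p q c =
  let x0 = (q * c) /' p ; r = (q * c) %' p in
  crossing (suc x0 , c) (x0 , c) (nearFrom false r p)

-- Diagonal crossing x+y = c : σ from (a,c-a) (left of γ) to (a+1,c-a-1) (right),
-- a = ⌊qc/(p+q)⌋, position measured in the x-coordinate.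
diagonal : ℕ → ℕ → ℕ → Crossing
diagonal p q c =
  let a = (q * c) /' (p + q) ; r = (q * c) %' (p + q) in
  crossing (suc a , c ∸ a ∸ 1) (a , c ∸ a) (nearFrom false r (p + q))

crossingAt : ℕ → ℕ → ℕ → Maybe Crossing
crossingAt p q T =
  if T %' (p * (p + q)) ≡ᵇ 0 then just (vertical p q (T /' (p * (p + q))))
  else if T %' (q * (p + q)) ≡ᵇ 0 then just (horizontal p q (T /' (q * (p + q))))
  else if T %' (p * q) ≡ᵇ 0 then just (diagonal p q (T /' (p * q)))
  else nothing

-- σ_1, …, σ_N in the order γ crosses them (times T = 1, …, pq(p+q) − 1).
crossings : ℕ → ℕ → List Crossing
crossings p q = mapMaybe (crossingAt p q) (map suc (upTo (p * q * (p + q) ∸ 1)))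

-- f_{2i-1}; s is the chosen sign of the middle crossing (the one at a midpoint).
crossSign : Sign → Crossing → Sign
crossSign s σ with near σ
... | nearRight = minus
... | nearLeft  = plus
... | midpoint  = s

samePoint : Point → Point → Bool
samePoint (x , y) (x' , y') = (x ≡ᵇ x') ∧ (y ≡ᵇ y')

-- f_{2i}: minus iff the common endpoint of σ_i, σ_{i+1} is right of γ
-- (i.e. the two segments share their right endpoint; otherwise they share
-- their left endpoint).
jointSign : Crossing → Crossing → Sign
jointSign σ τ = if samePoint (rightEnd σ) (rightEnd τ) then minus else plus

signsFrom : Sign → List Crossing → List Sign
signsFrom s []            = plus ∷ []
signsFrom s (σ ∷ [])      = crossSign s σ ∷ plus ∷ []
signsFrom s (σ ∷ τ ∷ σs)  = crossSign s σ ∷ jointSign σ τ ∷ signsFrom s (τ ∷ σs)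

fSeq : ℕ → ℕ → Sign → List Sign
fSeq p q s = minus ∷ signsFrom s (crossings p q)

runsFrom : Sign → ℕ → List Sign → List ℕ
runsFrom x n []       = n ∷ []
runsFrom x n (y ∷ ys) = if x =ˢ y then runsFrom x (suc n) ys else n ∷ runsFrom y 1 ys

runs : List Sign → List ℕ
runs []       = []
runs (x ∷ xs) = runsFrom x 1 xs

C[_/_] : ℕ → ℕ → Sign → List ℕ
C[ p / q ] s = runs (fSeq p q s)

-- Write n = p + q and let a k, r k be the quotient and remainder of q k by n, so that γ meets the
-- diagonal x + y = k at x = a k + r k / n.  Between the diagonals x + y = k and x + y = k + 1, γ
-- crosses exactly one further segment: on the vertical line x = a k + 1 if r k ≥ p, and on the
-- horizontal line y = k − a k otherwise.  Hence f(p/q) is −, followed by one block (diagonal,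
-- joint, off-diagonal crossing, joint) for each k, the last diagonal and +.  The joints around a
-- vertical crossing are −, + and those around a horizontal one +, −, while the crossing signs
-- compare r k (or n − r k) with half of n, p or q.  Counting block by block, the signs up to the
-- diagonal x + y = k, followed by a virtual −, change exactly 2 a k times; this locates the runs
-- a_{q−1}, a_q.  Around the middle crossing (the diagonal x + y = n/2, the horizontal y = p/2 or
-- the vertical x = q/2, according to parities) the signs are evaluated explicitly: they read i
-- equal signs, the middle sign, i opposite signs and the first sign again, so the two runs there
-- are i and i + 1 in some order.

module Submission where

open import Defs
open import Data.Bool.Base using (true; false; if_then_else_; _∧_)
open import Data.Bool.Properties using (∧-zeroʳ)
open import Data.Empty using (⊥-elim)
open import Data.List.Base using (List; []; _∷_; _++_; map; drop; length; replicate; applyUpTo; upTo; mapMaybe)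
open import Data.List.Properties using (++-assoc; mapMaybe-++; map-applyUpTo)
open import Data.Maybe.Base using (Maybe; just; nothing)
open import Data.Nat.Base
open import Data.Nat.Coprimality using (Coprime; coprime-+; coprime-divisor; gcd≡1⇒coprime)
open import Data.Nat.DivMod
open import Data.Nat.Divisibility using (_∣_; divides; ∣⇒≤; ∣m+n∣m⇒∣n; n∣m*n; m%n≡0⇒n∣m; n∣m⇒m%n≡0; >⇒∤)
open import Data.Nat.GCD using (gcd)
open import Data.Nat.Properties
open import Data.Nat.Tactic.RingSolver using (solve-∀; solve)
import Algebra.Properties.CommutativeSemigroup +-commutativeSemigroup as +-CS
import Algebra.Properties.CommutativeSemigroup *-commutativeSemigroup as *-CS
open import Data.Product.Base using (_×_; _,_; proj₁; proj₂; ∃-syntax; uncurry)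
open import Data.Sum.Base using (_⊎_; inj₁; inj₂)
open import Function.Base using (id; _∘_)
open import Relation.Binary.PropositionalEquality
open import Relation.Nullary using (¬_; yes; no)
open import Relation.Nullary.Reflects using (Reflects; ofʸ; ofⁿ; det; fromEquivalence)

-- The order facts of the case analysis are proved in this form, by ring normalisation.
m+o≡n⇒m≤n : ∀ {m n} o → m + o ≡ n → m ≤ n
m+o≡n⇒m≤n {m} o refl = m≤m+n m o

divMod-unique : ∀ {m d r} n .{{_ : NonZero n}} → m ≡ r + d * n → r < n → m / n ≡ d × m % n ≡ r
divMod-unique {d = d} {r} n refl r<n =
  trans (+-distrib-/-∣ʳ r (n∣m*n d)) (cong₂ _+_ (m<n⇒m/n≡0 r<n) (m*n/n≡m d n)) ,
  trans ([m+kn]%n≡m%n r d n) (m<n⇒m%n≡m r<n)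

/'≡/ : ∀ m n .{{_ : NonZero n}} → m /' n ≡ m / n
/'≡/ m (suc n) = refl

%'≡% : ∀ m n .{{_ : NonZero n}} → m %' n ≡ m % n
%'≡% m (suc n) = refl

reflects-true : ∀ {P : Set} {b} → Reflects P b → P → b ≡ true
reflects-true r x = det r (ofʸ x)

reflects-false : ∀ {P : Set} {b} → Reflects P b → ¬ P → b ≡ false
reflects-false r ¬x = det r (ofⁿ ¬x)

≡ᵇ-reflects-≡ : ∀ m n → Reflects (m ≡ n) (m ≡ᵇ n)
≡ᵇ-reflects-≡ m n = fromEquivalence (≡ᵇ⇒≡ m n) (≡⇒≡ᵇ m n)

if-true : ∀ {A : Set} {b} {x y : A} → b ≡ true → (if b then x else y) ≡ x
if-true refl = refl

if-false : ∀ {A : Set} {b} {x y : A} → b ≡ false → (if b then x else y) ≡ y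
if-false refl = refl

∣⇒%'≡ᵇ0 : ∀ {m} d .{{_ : NonZero d}} → d ∣ m → (m %' d ≡ᵇ 0) ≡ true
∣⇒%'≡ᵇ0 {m} d d∣m = reflects-true (≡ᵇ-reflects-≡ _ 0) (trans (%'≡% m d) (n∣m⇒m%n≡0 m d d∣m))

∤⇒%'≢ᵇ0 : ∀ {m} d .{{_ : NonZero d}} → ¬ d ∣ m → (m %' d ≡ᵇ 0) ≡ false
∤⇒%'≢ᵇ0 {m} d d∤m = reflects-false (≡ᵇ-reflects-≡ _ 0) (d∤m ∘ m%n≡0⇒n∣m m d ∘ trans (sym (%'≡% m d)))

range : ℕ → ℕ → List ℕ
range a zero    = []
range a (suc l) = a ∷ range (suc a) l

applyUpTo-range : ∀ (f : ℕ → ℕ) a l → (∀ i → f i ≡ a + i) → applyUpTo f l ≡ range a l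
applyUpTo-range f a zero    f≗ = refl
applyUpTo-range f a (suc l) f≗ = cong₂ _∷_ (trans (f≗ 0) (+-identityʳ a))
  (applyUpTo-range (f ∘ suc) (suc a) l (λ i → trans (f≗ (suc i)) (+-suc a i)))

map-suc-upTo : ∀ l → map suc (upTo l) ≡ range 1 l
map-suc-upTo l = trans (map-applyUpTo id suc l) (applyUpTo-range suc 1 l (λ _ → refl))

range-++ : ∀ a l₁ l₂ → range a (l₁ + l₂) ≡ range a l₁ ++ range (a + l₁) l₂
range-++ a zero     l₂ = cong (λ b → range b l₂) (sym (+-identityʳ a))
range-++ a (suc l₁) l₂ = cong (a ∷_) (trans (range-++ (suc a) l₁ l₂)
  (cong (λ b → range (suc a) l₁ ++ range b l₂) (sym (+-suc a l₁))))

module _ {A : Set} (g : ℕ → Maybe A) where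

  mapMaybe-just : ∀ {x xs e} → g x ≡ just e → mapMaybe g (x ∷ xs) ≡ e ∷ mapMaybe g xs
  mapMaybe-just {x} eq with g x
  mapMaybe-just refl | _ = refl

  mapMaybe-range-nothing : ∀ a l → (∀ T → a ≤ T → T < a + l → g T ≡ nothing) →
                           mapMaybe g (range a l) ≡ []
  mapMaybe-range-nothing a zero    none = refl
  mapMaybe-range-nothing a (suc l) none with g a | none a ≤-refl (m<m+n a z<s)
  ... | just _  | ()
  ... | nothing | _ = mapMaybe-range-nothing (suc a) l
    (λ T a<T T<a+l → none T (<⇒≤ a<T) (subst (T <_) (sym (+-suc a l)) T<a+l))

  mapMaybe-range-single : ∀ a l {T₀ e} → a ≤ T₀ → T₀ < a + l → g T₀ ≡ just e →
                          (∀ T → a ≤ T → T < a + l → T ≢ T₀ → g T ≡ nothing) →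
                          mapMaybe g (range a l) ≡ e ∷ []
  mapMaybe-range-single a zero    a≤T₀ T₀<a _ _ =
    ⊥-elim (<⇒≱ T₀<a (subst (_≤ _) (sym (+-identityʳ a)) a≤T₀))
  mapMaybe-range-single a (suc l) {T₀} {e} a≤T₀ T₀<a+l gT₀ others with a ≟ T₀
  ... | yes refl = trans (mapMaybe-just {xs = range (suc a) l} gT₀) (cong (e ∷_) (mapMaybe-range-nothing (suc a) l
          (λ T a<T T<a+l → others T (<⇒≤ a<T) (subst (T <_) (sym (+-suc a l)) T<a+l) (λ { refl → <-irrefl refl a<T }))))
  ... | no a≢T₀ with g a | others a ≤-refl (m<m+n a z<s) a≢T₀
  ...   | nothing | _ = mapMaybe-range-single (suc a) l (≤∧≢⇒< a≤T₀ a≢T₀) (subst (T₀ <_) (+-suc a l) T₀<a+l) gT₀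
          (λ T a<T T<a+l → others T (<⇒≤ a<T) (subst (T <_) (sym (+-suc a l)) T<a+l))

drop-++ : ∀ {A : Set} (xs ys : List A) → drop (length xs) (xs ++ ys) ≡ ys
drop-++ []       ys = refl
drop-++ (x ∷ xs) ys = drop-++ xs ys

-- Sign changes and runs

opposite : Sign → Sign
opposite minus = plus
opposite plus  = minus

neq : Sign → Sign → ℕ
neq x y = if x =ˢ y then 0 else 1

changesFrom : Sign → List Sign → ℕ
changesFrom x []       = 0
changesFrom x (y ∷ ys) = neq x y + changesFrom y ys

lastFrom : Sign → List Sign → Sign
lastFrom x []       = x
lastFrom x (y ∷ ys) = lastFrom y ys

changesFrom-++ : ∀ x xs ys → changesFrom x (xs ++ ys) ≡ changesFrom x xs + changesFrom (lastFrom x xs) ys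
changesFrom-++ x []       ys = refl
changesFrom-++ x (y ∷ xs) ys = trans (cong (neq x y +_) (changesFrom-++ y xs ys)) (sym (+-assoc (neq x y) _ _))

lastFrom-++ : ∀ x xs ys → lastFrom x (xs ++ ys) ≡ lastFrom (lastFrom x xs) ys
lastFrom-++ x []       ys = refl
lastFrom-++ x (y ∷ xs) ys = lastFrom-++ y xs ys

changesFrom-through : ∀ {x y} e ys → x ≢ y → changesFrom x (e ∷ y ∷ ys) ≡ suc (changesFrom y ys)
changesFrom-through {minus} {minus} e     ys x≢y = ⊥-elim (x≢y refl)
changesFrom-through {minus} {plus}  minus ys _   = refl
changesFrom-through {minus} {plus}  plus  ys _   = refl
changesFrom-through {plus}  {minus} minus ys _   = refl
changesFrom-through {plus}  {minus} plus  ys _   = refl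
changesFrom-through {plus}  {plus}  e     ys x≢y = ⊥-elim (x≢y refl)

changes-vertical-block : ∀ ℓ d e d′ →
  changesFrom ℓ (d ∷ minus ∷ e ∷ plus ∷ d′ ∷ minus ∷ []) ≡ changesFrom ℓ (d ∷ minus ∷ []) + 2
changes-vertical-block ℓ d e d′ = trans (changesFrom-++ ℓ (d ∷ minus ∷ []) (e ∷ plus ∷ d′ ∷ minus ∷ []))
  (cong (changesFrom ℓ (d ∷ minus ∷ []) +_)
        (trans (changesFrom-through {minus} {plus} e (d′ ∷ minus ∷ []) (λ ()))
               (cong suc (changesFrom-through {plus} {minus} d′ [] (λ ())))))

changes-horizontal-block : ∀ ℓ e →
  changesFrom ℓ (plus ∷ plus ∷ e ∷ minus ∷ minus ∷ minus ∷ []) ≡ changesFrom ℓ (plus ∷ minus ∷ [])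
changes-horizontal-block ℓ e = cong (neq ℓ plus +_) (changesFrom-through {plus} {minus} e (minus ∷ minus ∷ []) (λ ()))

runsFrom-same : ∀ x k ys → runsFrom x k (x ∷ ys) ≡ runsFrom x (suc k) ys
runsFrom-same minus k ys = refl
runsFrom-same plus  k ys = refl

runsFrom-switch : ∀ {x y} k ys → x ≢ y → runsFrom x k (y ∷ ys) ≡ k ∷ runsFrom y 1 ys
runsFrom-switch {minus} {minus} k ys x≢y = ⊥-elim (x≢y refl)
runsFrom-switch {minus} {plus}  k ys _   = refl
runsFrom-switch {plus}  {minus} k ys _   = refl
runsFrom-switch {plus}  {plus}  k ys x≢y = ⊥-elim (x≢y refl)

length-runsFrom : ∀ x k xs → length (runsFrom x k xs) ≡ suc (changesFrom x xs)
length-runsFrom x k []           = refl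
length-runsFrom minus k (minus ∷ xs) = length-runsFrom minus (suc k) xs
length-runsFrom minus k (plus  ∷ xs) = cong suc (length-runsFrom plus 1 xs)
length-runsFrom plus  k (minus ∷ xs) = cong suc (length-runsFrom minus 1 xs)
length-runsFrom plus  k (plus  ∷ xs) = length-runsFrom plus (suc k) xs

runsFrom-++ : ∀ x k xs y ys → lastFrom x xs ≢ y → runsFrom x k (xs ++ y ∷ ys) ≡ runsFrom x k xs ++ runsFrom y 1 ys
runsFrom-++ x     k []           y ys x≢y = runsFrom-switch k ys x≢y
runsFrom-++ minus k (minus ∷ xs) y ys ℓ≢y = runsFrom-++ minus (suc k) xs y ys ℓ≢y
runsFrom-++ minus k (plus  ∷ xs) y ys ℓ≢y = cong (k ∷_) (runsFrom-++ plus 1 xs y ys ℓ≢y)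
runsFrom-++ plus  k (minus ∷ xs) y ys ℓ≢y = cong (k ∷_) (runsFrom-++ minus 1 xs y ys ℓ≢y)
runsFrom-++ plus  k (plus  ∷ xs) y ys ℓ≢y = runsFrom-++ plus (suc k) xs y ys ℓ≢y

drop-runs : ∀ x xs y ys → lastFrom x xs ≢ y →
            drop (suc (changesFrom x xs)) (runs (x ∷ xs ++ y ∷ ys)) ≡ runs (y ∷ ys)
drop-runs x xs y ys ℓ≢y = begin
    drop (suc (changesFrom x xs)) (runsFrom x 1 (xs ++ y ∷ ys))
  ≡⟨ cong₂ drop (sym (length-runsFrom x 1 xs)) (runsFrom-++ x 1 xs y ys ℓ≢y) ⟩
    drop (length (runsFrom x 1 xs)) (runsFrom x 1 xs ++ runsFrom y 1 ys)
  ≡⟨ drop-++ (runsFrom x 1 xs) _ ⟩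
    runsFrom y 1 ys
  ∎
  where open ≡-Reasoning

runsFrom-replicate : ∀ x k i ys → runsFrom x k (replicate i x ++ ys) ≡ runsFrom x (k + i) ys
runsFrom-replicate x k zero    ys = cong (λ j → runsFrom x j ys) (sym (+-identityʳ k))
runsFrom-replicate x k (suc i) ys = begin
    runsFrom x k (x ∷ replicate i x ++ ys) ≡⟨ runsFrom-same x k (replicate i x ++ ys) ⟩
    runsFrom x (suc k) (replicate i x ++ ys) ≡⟨ runsFrom-replicate x (suc k) i ys ⟩
    runsFrom x (suc k + i) ys ≡⟨ cong (λ j → runsFrom x j ys) (sym (+-suc k i)) ⟩
    runsFrom x (k + suc i) ys ∎
  where open ≡-Reasoning

FirstTwoAre : ℕ → ℕ → List ℕ → Set
FirstTwoAre i j xs = ∃[ rest ] (xs ≡ i ∷ j ∷ rest ⊎ xs ≡ j ∷ i ∷ rest)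

runs-around : ∀ i x s xs → FirstTwoAre (suc i) (suc (suc i))
                (runs (replicate (suc i) x ++ s ∷ replicate (suc i) (opposite x) ++ x ∷ xs))
runs-around i minus minus xs = _ , inj₂ (trans (runsFrom-replicate minus 1 i _) (cong (_ ∷_) (runsFrom-replicate plus 1 i _)))
runs-around i minus plus  xs = _ , inj₁ (trans (runsFrom-replicate minus 1 i _) (cong (_ ∷_) (runsFrom-replicate plus 2 i _)))
runs-around i plus  minus xs = _ , inj₁ (trans (runsFrom-replicate plus 1 i _) (cong (_ ∷_) (runsFrom-replicate minus 2 i _)))
runs-around i plus  plus  xs = _ , inj₂ (trans (runsFrom-replicate plus 1 i _) (cong (_ ∷_) (runsFrom-replicate minus 1 i _)))

samePoint-≡ : ∀ {P Q} → P ≡ Q → samePoint P Q ≡ true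
samePoint-≡ {x , y} refl = cong₂ _∧_ (reflects-true (≡ᵇ-reflects-≡ x x) refl) (reflects-true (≡ᵇ-reflects-≡ y y) refl)

samePoint-≢₁ : ∀ {x y x′ y′} → x ≢ x′ → samePoint (x , y) (x′ , y′) ≡ false
samePoint-≢₁ {x} {y} {x′} {y′} x≢x′ = cong (_∧ (y ≡ᵇ y′)) (reflects-false (≡ᵇ-reflects-≡ x x′) x≢x′)

samePoint-≢₂ : ∀ {x y x′ y′} → y ≢ y′ → samePoint (x , y) (x′ , y′) ≡ false
samePoint-≢₂ {x} {y} {x′} {y′} y≢y′ = trans (cong ((x ≡ᵇ x′) ∧_) (reflects-false (≡ᵇ-reflects-≡ y y′) y≢y′)) (∧-zeroʳ _)

jointSign-meet : ∀ σ τ → rightEnd σ ≡ rightEnd τ → jointSign σ τ ≡ minus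
jointSign-meet σ τ eq = if-true (samePoint-≡ eq)

jointSign-apart₁ : ∀ σ τ → proj₁ (rightEnd σ) ≢ proj₁ (rightEnd τ) → jointSign σ τ ≡ plus
jointSign-apart₁ σ τ ne = if-false (samePoint-≢₁ {y = proj₂ (rightEnd σ)} {y′ = proj₂ (rightEnd τ)} ne)

jointSign-apart₂ : ∀ σ τ → proj₂ (rightEnd σ) ≢ proj₂ (rightEnd τ) → jointSign σ τ ≡ plus
jointSign-apart₂ σ τ ne = if-false (samePoint-≢₂ {x = proj₁ (rightEnd σ)} {x′ = proj₁ (rightEnd τ)} ne)

nearSign : Sign → Near → Sign
nearSign s nearRight = minus
nearSign s nearLeft  = plus
nearSign s midpoint  = s

crossSign≡nearSign : ∀ s σ → crossSign s σ ≡ nearSign s (near σ)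
crossSign≡nearSign s σ with near σ
... | nearRight = refl
... | nearLeft  = refl
... | midpoint  = refl

nearFrom-below : ∀ b ρ m → 2 * ρ < m → nearFrom b ρ m ≡ (if b then nearRight else nearLeft)
nearFrom-below b ρ m lt = if-true (reflects-true (<ᵇ-reflects-< _ _) lt)

nearFrom-above : ∀ b ρ m → m < 2 * ρ → nearFrom b ρ m ≡ (if b then nearLeft else nearRight)
nearFrom-above b ρ m lt = trans (if-false (reflects-false (<ᵇ-reflects-< _ _) (<-asym lt))) (if-true (reflects-true (<ᵇ-reflects-< _ _) lt))

nearFrom-middle : ∀ b ρ m → 2 * ρ ≡ m → nearFrom b ρ m ≡ midpoint
nearFrom-middle b ρ m eq = trans (if-false (reflects-false (<ᵇ-reflects-< _ _) (<-irrefl eq)))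
                              (if-false (reflects-false (<ᵇ-reflects-< _ _) (<-irrefl (sym eq))))

crossSign-near : ∀ s σ {ν} → near σ ≡ ν → crossSign s σ ≡ nearSign s ν
crossSign-near s σ eq = trans (crossSign≡nearSign s σ) (cong (nearSign s) eq)

-- The crossings of γ

module Crossings (p q : ℕ) .{{_ : NonZero p}} (p<q : p < q) (coprime : Coprime p q) where

  n R : ℕ
  n = p + q
  R = p * q

  instance
    q≢0 : NonZero q
    q≢0 = >-nonZero (<-trans (>-nonZero⁻¹ p) p<q)
    n≢0 : NonZero n
    n≢0 = >-nonZero (<-≤-trans (>-nonZero⁻¹ p) (m≤m+n p q))
    pn≢0 : NonZero (p * n)
    pn≢0 = m*n≢0 p n
    qn≢0 : NonZero (q * n)
    qn≢0 = m*n≢0 q n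
    R≢0 : NonZero R
    R≢0 = m*n≢0 p q

  2p<n : 2 * p < n
  2p<n = +-monoʳ-< p (subst (_< q) (sym (+-identityʳ p)) p<q)

  n<2q : n < 2 * q
  n<2q = subst (n <_) (cong (q +_) (sym (+-identityʳ q))) (+-monoˡ-< q p<q)

  a r : ℕ → ℕ
  a k = q * k / n
  r k = q * k % n

  qk≡r+a*n : ∀ k → q * k ≡ r k + a k * n
  qk≡r+a*n k = m≡m%n+[m/n]*n (q * k) n

  r<n : ∀ k → r k < n
  r<n k = m%n<n (q * k) n

  k*q≡r+a*n : ∀ k → k * q ≡ r k + a k * n
  k*q≡r+a*n k = trans (*-comm k q) (qk≡r+a*n k)

  k*q+q≡r+[q+a*n] : ∀ k → k * q + q ≡ r k + (q + a k * n)
  k*q+q≡r+[q+a*n] k = trans (cong (_+ q) (k*q≡r+a*n k)) (+-CS.xy∙z≈x∙zy (r k) (a k * n) q)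

  -- Lemmas instantiated by the case analysis write p + q rather than n, which the ring
  -- solver could not unfold.
  divMod-qk : ∀ k A ρ → q * k ≡ ρ + A * (p + q) → ρ < p + q → a k ≡ A × r k ≡ ρ
  divMod-qk k A ρ = divMod-unique n

  r≢0 : ∀ {k} → 1 ≤ k → k < n → r k ≢ 0
  r≢0 {k} 1≤k k<n rk≡0 = <⇒≱ k<n (∣⇒≤ {{>-nonZero 1≤k}} n∣k)
    where
      n∣k : n ∣ k
      n∣k = coprime-divisor (subst (λ m → Coprime m q) (+-comm q p) (coprime-+ coprime))
                            (m%n≡0⇒n∣m (q * k) n rk≡0)

  a<k : ∀ {k} → 1 ≤ k → a k < k
  a<k {k} 1≤k = *-cancelʳ-< n (a k) k (begin-strict
      a k * n        ≤⟨ m≤n+m (a k * n) (r k) ⟩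
      r k + a k * n  ≡⟨ sym (qk≡r+a*n k) ⟩
      q * k          ≡⟨ *-comm q k ⟩
      k * q          <⟨ *-monoʳ-< k {{>-nonZero 1≤k}} (m<n+m q (>-nonZero⁻¹ p)) ⟩
      k * n          ∎)
    where open ≤-Reasoning

  r-step-horizontal : ∀ k → r k < p → a (suc k) ≡ a k × r (suc k) ≡ r k + q
  r-step-horizontal k rk<p = divMod-unique n (begin
      q * suc k            ≡⟨ *-suc q k ⟩
      q + q * k            ≡⟨ cong (q +_) (qk≡r+a*n k) ⟩
      q + (r k + a k * n)  ≡⟨ +-CS.x∙yz≈yx∙z q (r k) (a k * n) ⟩
      r k + q + a k * n    ∎) (+-monoˡ-< q rk<p)
    where open ≡-Reasoning

  r-step-vertical : ∀ k → p ≤ r k → a (suc k) ≡ suc (a k) × r (suc k) ≡ r k ∸ p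
  r-step-vertical k p≤rk = divMod-unique n (begin
      q * suc k                    ≡⟨ *-suc q k ⟩
      q + q * k                    ≡⟨ cong (q +_) (qk≡r+a*n k) ⟩
      q + (r k + a k * n)          ≡⟨ cong (λ x → q + (x + a k * n)) (sym (m∸n+n≡m p≤rk)) ⟩
      q + (r k ∸ p + p + a k * n)  ≡⟨ shuffle q (r k ∸ p) p (a k * n) ⟩
      r k ∸ p + suc (a k) * n      ∎) (≤-<-trans (m∸n≤m (r k) p) (r<n k))
    where
      open ≡-Reasoning
      shuffle : ∀ x y z w → x + (y + z + w) ≡ y + (z + x + w)
      shuffle = solve-∀

  r-last : ∀ {k} → suc k ≡ n → r k ≡ p
  r-last {k} sk≡n = proj₂ (divMod-unique {d = pred q} n qk≡p+[q-1]n (m<m+n p (>-nonZero⁻¹ q)))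
    where
      open ≡-Reasoning
      qk≡p+[q-1]n : q * k ≡ p + pred q * n
      qk≡p+[q-1]n = +-cancelˡ-≡ q _ _ (begin
        q + q * k             ≡⟨ sym (*-suc q k) ⟩
        q * suc k             ≡⟨ cong (q *_) sk≡n ⟩
        q * n                 ≡⟨ cong (_* n) (sym (suc-pred q)) ⟩
        p + q + pred q * n    ≡⟨ +-CS.xy∙z≈y∙xz p q (pred q * n) ⟩
        q + (p + pred q * n)  ∎)

  r≢p : ∀ {k} → suc k < n → r k ≢ p
  r≢p {k} sk<n rk≡p = r≢0 z<s sk<n (begin
      r (suc k)  ≡⟨ proj₂ (r-step-vertical k (≤-reflexive (sym rk≡p))) ⟩
      r k ∸ p    ≡⟨ cong (_∸ p) rk≡p ⟩
      p ∸ p      ≡⟨ n∸n≡0 p ⟩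
      0          ∎)
    where open ≡-Reasoning

  [k∸a]*n≡k*p+r : ∀ {k} → 1 ≤ k → (k ∸ a k) * n ≡ k * p + r k
  [k∸a]*n≡k*p+r {k} 1≤k = +-cancelʳ-≡ (a k * n) _ _ (begin
      (k ∸ a k) * n + a k * n  ≡⟨ sym (*-distribʳ-+ n (k ∸ a k) (a k)) ⟩
      (k ∸ a k + a k) * n      ≡⟨ cong (_* n) (m∸n+n≡m (<⇒≤ (a<k 1≤k))) ⟩
      k * n                    ≡⟨ *-distribˡ-+ k p q ⟩
      k * p + k * q            ≡⟨ cong (k * p +_) (k*q≡r+a*n k) ⟩
      k * p + (r k + a k * n)  ≡⟨ sym (+-assoc (k * p) (r k) _) ⟩
      k * p + r k + a k * n    ∎)
    where open ≡-Reasoning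

  q*[k∸a]≡r+a*p : ∀ {k} → 1 ≤ k → q * (k ∸ a k) ≡ r k + a k * p
  q*[k∸a]≡r+a*p {k} 1≤k = +-cancelˡ-≡ (j * p) _ _ (begin
      j * p + q * j            ≡⟨ distrib j p q ⟩
      j * n                    ≡⟨ [k∸a]*n≡k*p+r 1≤k ⟩
      k * p + r k              ≡⟨ cong (λ x → x * p + r k) (sym (m∸n+n≡m (<⇒≤ (a<k 1≤k)))) ⟩
      (j + a k) * p + r k      ≡⟨ regroup j (a k) p (r k) ⟩
      j * p + (r k + a k * p)  ∎)
    where
      open ≡-Reasoning
      j : ℕ
      j = k ∸ a k
      distrib : ∀ x y z → x * y + z * x ≡ x * (y + z)
      distrib = solve-∀
      regroup : ∀ x y z w → (x + y) * z + w ≡ x * z + (w + y * z)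
      regroup = solve-∀

  horizontal-divMod : ∀ {k} → 1 ≤ k → r k < p → q * (k ∸ a k) / p ≡ a k × q * (k ∸ a k) % p ≡ r k
  horizontal-divMod 1≤k rk<p = divMod-unique p (q*[k∸a]≡r+a*p 1≤k) rk<p

  vertical-divMod : ∀ {k σ} → 1 ≤ k → p < r k → r k + σ ≡ n →
                    p * suc (a k) / q ≡ k ∸ suc (a k) × p * suc (a k) % q ≡ σ
  vertical-divMod {k} {σ} 1≤k p<rk rk+σ≡n = divMod-unique q p[1+a]≡σ+b*q σ<q
    where
      open ≡-Reasoning
      A b : ℕ
      A = a k
      b = k ∸ suc A
      σ<q : σ < q
      σ<q = +-cancelˡ-< (r k) σ q (subst (_< r k + q) (sym rk+σ≡n) (+-monoˡ-< q p<rk))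
      expand : ∀ x y z → x * suc z + y * suc z ≡ x + y + z * (x + y)
      expand = solve-∀
      collect : ∀ x y z w → x + y * (z + suc w) ≡ x + z * y + y * suc w
      collect = solve-∀
      p[1+a]≡σ+b*q : p * suc A ≡ σ + b * q
      p[1+a]≡σ+b*q = +-cancelʳ-≡ (q * suc A) _ _ (begin
        p * suc A + q * suc A    ≡⟨ expand p q A ⟩
        n + A * n                ≡⟨ cong (_+ A * n) (sym rk+σ≡n) ⟩
        r k + σ + A * n          ≡⟨ +-CS.xy∙z≈y∙xz (r k) σ (A * n) ⟩
        σ + (r k + A * n)        ≡⟨ cong (σ +_) (sym (qk≡r+a*n k)) ⟩
        σ + q * k                ≡⟨ cong (λ x → σ + q * x) (sym (m∸n+n≡m (a<k 1≤k))) ⟩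
        σ + q * (b + suc A)      ≡⟨ collect σ q b A ⟩
        σ + b * q + q * suc A    ∎)

  vertical-multiple : ∀ {k c} → k * q < c * n → c * n < k * q + q → c ≡ suc (a k) × p < r k
  vertical-multiple {k} {c} lo hi = c≡1+a , p<rk
    where
      open ≤-Reasoning
      a<c : a k < c
      a<c = *-cancelʳ-< n (a k) c (≤-<-trans (m≤n+m (a k * n) (r k)) (subst (_< c * n) (k*q≡r+a*n k) lo))
      c<2+a : c < suc (suc (a k))
      c<2+a = *-cancelʳ-< n c (suc (suc (a k))) (begin-strict
        c * n                <⟨ hi ⟩
        k * q + q            ≡⟨ k*q+q≡r+[q+a*n] k ⟩
        r k + (q + a k * n)  <⟨ +-mono-< (r<n k) (+-monoˡ-< (a k * n) (m<n+m q (>-nonZero⁻¹ p))) ⟩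
        n + (n + a k * n)    ∎)
      c≡1+a : c ≡ suc (a k)
      c≡1+a = ≤-antisym (s≤s⁻¹ c<2+a) a<c
      p<rk : p < r k
      p<rk = +-cancelʳ-< (q + a k * n) p (r k) (begin-strict
        p + (q + a k * n)    ≡⟨ sym (+-assoc p q _) ⟩
        suc (a k) * n        ≡⟨ cong (_* n) (sym c≡1+a) ⟩
        c * n                <⟨ hi ⟩
        k * q + q            ≡⟨ k*q+q≡r+[q+a*n] k ⟩
        r k + (q + a k * n)  ∎)

  horizontal-multiple : ∀ {k j} → 1 ≤ k → k * p < j * n → j * n < k * p + p → j ≡ k ∸ a k × r k < p
  horizontal-multiple {k} {j} 1≤k lo hi = j≡k∸a , rk<p
    where
      open ≤-Reasoning
      j₀ : ℕ
      j₀ = k ∸ a k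
      j₀n≡ : j₀ * n ≡ k * p + r k
      j₀n≡ = [k∸a]*n≡k*p+r 1≤k
      j₀≤j : j₀ ≤ j
      j₀≤j = ≮⇒≥ λ j<j₀ → <-asym lo (+-cancelʳ-< n (j * n) (k * p) (begin-strict
        j * n + n          ≡⟨ +-comm (j * n) n ⟩
        suc j * n          ≤⟨ *-monoˡ-≤ n j<j₀ ⟩
        j₀ * n             ≡⟨ j₀n≡ ⟩
        k * p + r k        <⟨ +-monoʳ-< (k * p) (r<n k) ⟩
        k * p + n          ∎))
      j≤j₀ : j ≤ j₀
      j≤j₀ = ≮⇒≥ λ j₀<j → <-asym hi (begin-strict
        k * p + p          <⟨ +-monoʳ-< (k * p) (m<m+n p (>-nonZero⁻¹ q)) ⟩
        k * p + n          ≤⟨ m≤m+n (k * p + n) (r k) ⟩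
        k * p + n + r k    ≡⟨ +-CS.xy∙z≈y∙xz (k * p) n (r k) ⟩
        n + (k * p + r k)  ≡⟨ cong (n +_) (sym j₀n≡) ⟩
        suc j₀ * n         ≤⟨ *-monoˡ-≤ n j₀<j ⟩
        j * n              ∎)
      j≡k∸a : j ≡ j₀
      j≡k∸a = ≤-antisym j≤j₀ j₀≤j
      rk<p : r k < p
      rk<p = +-cancelˡ-< (k * p) (r k) p (subst (_< k * p + p) (trans (cong (_* n) j≡k∸a) j₀n≡) hi)

  vertical-in-interval : ∀ k → p < r k → k * q < suc (a k) * n × suc (a k) * n < k * q + q
  vertical-in-interval k p<rk =
      subst (_< suc (a k) * n) (sym (k*q≡r+a*n k)) (+-monoˡ-< (a k * n) (r<n k))
    , (begin-strict
        suc (a k) * n        ≡⟨ +-assoc p q _ ⟩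
        p + (q + a k * n)    <⟨ +-monoˡ-< (q + a k * n) p<rk ⟩
        r k + (q + a k * n)  ≡⟨ sym (k*q+q≡r+[q+a*n] k) ⟩
        k * q + q            ∎)
    where open ≤-Reasoning

  horizontal-in-interval : ∀ {k} → 1 ≤ k → k < n → r k < p → k * p < (k ∸ a k) * n × (k ∸ a k) * n < k * p + p
  horizontal-in-interval {k} 1≤k k<n rk<p =
      subst (k * p <_) (sym Jn≡) (m<m+n (k * p) (n≢0⇒n>0 (r≢0 1≤k k<n)))
    , subst (_< k * p + p) (sym Jn≡) (+-monoʳ-< (k * p) rk<p)
    where
      Jn≡ : (k ∸ a k) * n ≡ k * p + r k
      Jn≡ = [k∸a]*n≡k*p+r 1≤k

  scale-interval : ∀ m m′ .{{_ : NonZero m}} {k c} → k * m′ < c * n → c * n < k * m′ + m′ →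
                   k * (m * m′) < c * (m * n) × c * (m * n) < k * (m * m′) + m * m′
  scale-interval m m′ {k} {c} lo hi =
      subst₂ _<_ (sym (*-CS.x∙yz≈y∙xz k m m′)) (sym (*-CS.x∙yz≈y∙xz c m n)) (*-monoʳ-< m lo)
    , subst₂ _<_ (sym (*-CS.x∙yz≈y∙xz c m n)) (sym (swap+ k m m′)) (*-monoʳ-< m hi)
    where
      swap+ : ∀ x y z → x * (y * z) + y * z ≡ y * (x * z + z)
      swap+ = solve-∀

  unscale-interval : ∀ m m′ {k c} → k * (m * m′) < c * (m * n) → c * (m * n) < k * (m * m′) + m * m′ →
                     k * m′ < c * n × c * n < k * m′ + m′
  unscale-interval m m′ {k} {c} lo hi =
      *-cancelˡ-< m (k * m′) (c * n) (subst₂ _<_ (*-CS.x∙yz≈y∙xz k m m′) (*-CS.x∙yz≈y∙xz c m n) lo)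
    , *-cancelˡ-< m (c * n) (k * m′ + m′) (subst₂ _<_ (*-CS.x∙yz≈y∙xz c m n) (swap+ k m m′) hi)
    where
      swap+ : ∀ x y z → x * (y * z) + y * z ≡ y * (x * z + z)
      swap+ = solve-∀

  R≡q*p : R ≡ q * p
  R≡q*p = *-comm p q

  R∤-between : ∀ k {T} → k * R < T → T < k * R + R → ¬ R ∣ T
  R∤-between k lo hi (divides c refl) =
    <⇒≱ (*-cancelʳ-< R k c lo) (s≤s⁻¹ (*-cancelʳ-< R c (suc k) (subst (c * R <_) (+-comm (k * R) R) hi)))

  vertical-between : ∀ k {T} → k * R < T → T < k * R + R → p * n ∣ T → p < r k × T ≡ suc (a k) * (p * n)
  vertical-between k lo hi (divides c refl) with unscale-interval p q {k} {c} lo hi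
  ... | lo′ , hi′ with vertical-multiple {k} {c} lo′ hi′
  ...   | c≡1+a , p<rk = p<rk , cong (_* (p * n)) c≡1+a

  horizontal-between : ∀ k {T} → 1 ≤ k → k * R < T → T < k * R + R → q * n ∣ T → r k < p × T ≡ (k ∸ a k) * (q * n)
  horizontal-between k 1≤k lo hi (divides j refl)
    with unscale-interval q p {k} {j} (subst (λ x → k * x < j * (q * n)) R≡q*p lo)
                                      (subst (λ x → j * (q * n) < k * x + x) R≡q*p hi)
  ... | lo′ , hi′ with horizontal-multiple {k} {j} 1≤k lo′ hi′
  ...   | j≡k∸a , rk<p = rk<p , cong (_* (q * n)) j≡k∸a

  crossingAt-vertical : ∀ {T} → p * n ∣ T → crossingAt p q T ≡ just (vertical p q (T / (p * n)))
  crossingAt-vertical {T} pn∣T =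
    trans (if-true (∣⇒%'≡ᵇ0 (p * n) pn∣T)) (cong (just ∘ vertical p q) (/'≡/ T (p * n)))

  crossingAt-horizontal : ∀ {T} → ¬ p * n ∣ T → q * n ∣ T → crossingAt p q T ≡ just (horizontal p q (T / (q * n)))
  crossingAt-horizontal {T} pn∤T qn∣T = trans (if-false (∤⇒%'≢ᵇ0 (p * n) pn∤T))
    (trans (if-true (∣⇒%'≡ᵇ0 (q * n) qn∣T)) (cong (just ∘ horizontal p q) (/'≡/ T (q * n))))

  crossingAt-diagonal : ∀ {T} → ¬ p * n ∣ T → ¬ q * n ∣ T → R ∣ T → crossingAt p q T ≡ just (diagonal p q (T / R))
  crossingAt-diagonal {T} pn∤T qn∤T R∣T = trans (if-false (∤⇒%'≢ᵇ0 (p * n) pn∤T))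
    (trans (if-false (∤⇒%'≢ᵇ0 (q * n) qn∤T)) (trans (if-true (∣⇒%'≡ᵇ0 R R∣T)) (cong (just ∘ diagonal p q) (/'≡/ T R))))

  crossingAt-nothing : ∀ {T} → ¬ p * n ∣ T → ¬ q * n ∣ T → ¬ R ∣ T → crossingAt p q T ≡ nothing
  crossingAt-nothing pn∤T qn∤T R∤T = trans (if-false (∤⇒%'≢ᵇ0 (p * n) pn∤T))
    (trans (if-false (∤⇒%'≢ᵇ0 (q * n) qn∤T)) (if-false (∤⇒%'≢ᵇ0 R R∤T)))

  crossingAt-diagonal-time : ∀ {k} → 1 ≤ k → k < n → crossingAt p q (k * R) ≡ just (diagonal p q k)
  crossingAt-diagonal-time {k} 1≤k k<n =
    trans (crossingAt-diagonal pn∤kR qn∤kR (n∣m*n k)) (cong (just ∘ diagonal p q) (m*n/n≡m k R))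
    where
      n∤qk : ¬ n ∣ q * k
      n∤qk = r≢0 1≤k k<n ∘ n∣m⇒m%n≡0 (q * k) n
      distrib : ∀ x y z → x * y + z * x ≡ x * (y + z)
      distrib = solve-∀
      pn∤kR : ¬ p * n ∣ k * R
      pn∤kR (divides c kR≡) = n∤qk (divides c
        (*-cancelˡ-≡ (q * k) (c * n) p (trans (sym (*-CS.x∙yz≈y∙zx k p q)) (trans kR≡ (*-CS.x∙yz≈y∙xz c p n)))))
      qn∤kR : ¬ q * n ∣ k * R
      qn∤kR (divides c kR≡) = n∤qk (∣m+n∣m⇒∣n (divides k (distrib k p q)) (divides c
        (*-cancelˡ-≡ (k * p) (c * n) q (trans (*-CS.x∙yz≈y∙zx q k p) (trans kR≡ (*-CS.x∙yz≈y∙xz c q n))))))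

  offDiagonal : ℕ → Crossing
  offDiagonal k = if p ≤ᵇ r k then vertical p q (suc (a k)) else horizontal p q (k ∸ a k)

  offDiagonal-vertical : ∀ {k} → p ≤ r k → offDiagonal k ≡ vertical p q (suc (a k))
  offDiagonal-vertical {k} p≤rk = if-true (reflects-true (≤ᵇ-reflects-≤ p (r k)) p≤rk)

  offDiagonal-horizontal : ∀ {k} → r k < p → offDiagonal k ≡ horizontal p q (k ∸ a k)
  offDiagonal-horizontal {k} rk<p = if-false (reflects-false (≤ᵇ-reflects-≤ p (r k)) (<⇒≱ rk<p))

  -- Two functions, so that signsFrom s (crossingsFrom k (suc l)) reduces to
  -- block s k ++ signsFrom s (crossingsFrom (suc k) l).
  crossingsFrom crossingsAfter : ℕ → ℕ → List Crossing
  crossingsFrom k l = diagonal p q k ∷ crossingsAfter k l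
  crossingsAfter k zero    = []
  crossingsAfter k (suc l) = offDiagonal k ∷ crossingsFrom (suc k) l

  private
    γ : ℕ → Maybe Crossing
    γ = crossingAt p q

    1≤R : 1 ≤ R
    1≤R = >-nonZero⁻¹ R

  interior : ℕ → List ℕ
  interior k = range (suc (k * R)) (R ∸ 1)

  range-chunk : ∀ k → range (k * R) R ≡ k * R ∷ interior k
  range-chunk k = cong (range (k * R)) (sym (m+[n∸m]≡n 1≤R))

  interior-end : ∀ k → suc (k * R) + (R ∸ 1) ≡ k * R + R
  interior-end k = trans (sym (+-suc (k * R) (R ∸ 1))) (cong (k * R +_) (m+[n∸m]≡n 1≤R))

  interior-vertical : ∀ {k} → 1 ≤ k → p < r k → mapMaybe γ (interior k) ≡ vertical p q (suc (a k)) ∷ []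
  interior-vertical {k} 1≤k p<rk =
    mapMaybe-range-single γ (suc (k * R)) (R ∸ 1) (proj₁ bounds) (subst (T₀ <_) (sym (interior-end k)) (proj₂ bounds)) hit others
    where
      T₀ : ℕ
      T₀ = suc (a k) * (p * n)
      bounds : k * R < T₀ × T₀ < k * R + R
      bounds = uncurry (scale-interval p q {k} {suc (a k)}) (vertical-in-interval k p<rk)
      hit : γ T₀ ≡ just (vertical p q (suc (a k)))
      hit = trans (crossingAt-vertical (n∣m*n (suc (a k)))) (cong (just ∘ vertical p q) (m*n/n≡m (suc (a k)) (p * n)))
      others : ∀ T → suc (k * R) ≤ T → T < suc (k * R) + (R ∸ 1) → T ≢ T₀ → γ T ≡ nothing
      others T lo hi T≢T₀ = crossingAt-nothing
          (T≢T₀ ∘ proj₂ ∘ vertical-between k lo hi′)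
          (λ qn∣T → <-asym p<rk (proj₁ (horizontal-between k 1≤k lo hi′ qn∣T)))
          (R∤-between k lo hi′)
        where
          hi′ : T < k * R + R
          hi′ = subst (T <_) (interior-end k) hi

  interior-horizontal : ∀ {k} → 1 ≤ k → k < n → r k < p → mapMaybe γ (interior k) ≡ horizontal p q (k ∸ a k) ∷ []
  interior-horizontal {k} 1≤k k<n rk<p =
    mapMaybe-range-single γ (suc (k * R)) (R ∸ 1) lo (subst (T₀ <_) (sym (interior-end k)) hi) hit others
    where
      T₀ : ℕ
      T₀ = (k ∸ a k) * (q * n)
      scaled : k * (q * p) < T₀ × T₀ < k * (q * p) + q * p
      scaled = uncurry (scale-interval q p {k} {k ∸ a k}) (horizontal-in-interval 1≤k k<n rk<p)
      lo : k * R < T₀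
      lo = subst (λ x → k * x < T₀) (sym R≡q*p) (proj₁ scaled)
      hi : T₀ < k * R + R
      hi = subst (λ x → T₀ < k * x + x) (sym R≡q*p) (proj₂ scaled)
      hit : γ T₀ ≡ just (horizontal p q (k ∸ a k))
      hit = trans (crossingAt-horizontal (λ pn∣T₀ → <-asym rk<p (proj₁ (vertical-between k lo hi pn∣T₀))) (n∣m*n (k ∸ a k)))
                  (cong (just ∘ horizontal p q) (m*n/n≡m (k ∸ a k) (q * n)))
      others : ∀ T → suc (k * R) ≤ T → T < suc (k * R) + (R ∸ 1) → T ≢ T₀ → γ T ≡ nothing
      others T lo hi T≢T₀ = crossingAt-nothing
          (λ pn∣T → <-asym rk<p (proj₁ (vertical-between k lo hi′ pn∣T)))
          (T≢T₀ ∘ proj₂ ∘ horizontal-between k 1≤k lo hi′)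
          (R∤-between k lo hi′)
        where
          hi′ : T < k * R + R
          hi′ = subst (T <_) (interior-end k) hi

  interior-last : ∀ {k} → 1 ≤ k → suc k ≡ n → mapMaybe γ (interior k) ≡ []
  interior-last {k} 1≤k sk≡n = mapMaybe-range-nothing γ (suc (k * R)) (R ∸ 1) (λ T lo hi →
    let hi′ = subst (T <_) (interior-end k) hi in crossingAt-nothing
      (λ pn∣T → <-irrefl (sym (r-last sk≡n)) (proj₁ (vertical-between k lo hi′ pn∣T)))
      (λ qn∣T → <-irrefl (r-last sk≡n) (proj₁ (horizontal-between k 1≤k lo hi′ qn∣T)))
      (R∤-between k lo hi′))

  chunk-head : ∀ {k} → 1 ≤ k → k < n → mapMaybe γ (range (k * R) R) ≡ diagonal p q k ∷ mapMaybe γ (interior k)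
  chunk-head {k} 1≤k k<n = trans (cong (mapMaybe γ) (range-chunk k))
                                 (mapMaybe-just γ {xs = interior k} (crossingAt-diagonal-time 1≤k k<n))

  chunk : ∀ {k} → 1 ≤ k → suc k < n → mapMaybe γ (range (k * R) R) ≡ diagonal p q k ∷ offDiagonal k ∷ []
  chunk {k} 1≤k sk<n = trans (chunk-head 1≤k k<n) (cong (diagonal p q k ∷_) off)
    where
      k<n : k < n
      k<n = <-trans (n<1+n k) sk<n
      off : mapMaybe γ (interior k) ≡ offDiagonal k ∷ []
      off with p ≤? r k
      ... | yes p≤rk = trans (interior-vertical 1≤k (≤∧≢⇒< p≤rk (r≢p sk<n ∘ sym)))
                             (cong (_∷ []) (sym (offDiagonal-vertical p≤rk)))
      ... | no  p≰rk = trans (interior-horizontal 1≤k k<n (≰⇒> p≰rk))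
                             (cong (_∷ []) (sym (offDiagonal-horizontal (≰⇒> p≰rk))))

  last-chunk : ∀ {k} → 1 ≤ k → suc k ≡ n → mapMaybe γ (range (k * R) R) ≡ diagonal p q k ∷ []
  last-chunk {k} 1≤k sk≡n = trans (chunk-head 1≤k (subst (k <_) sk≡n (n<1+n k)))
                                  (cong (diagonal p q k ∷_) (interior-last 1≤k sk≡n))

  chunks : ∀ {k} l → 1 ≤ k → suc (k + l) ≡ n → mapMaybe γ (range (k * R) (suc l * R)) ≡ crossingsFrom k l
  chunks {k} zero 1≤k sk≡n = trans (cong (mapMaybe γ ∘ range (k * R)) (+-identityʳ R))
    (last-chunk 1≤k (trans (cong suc (sym (+-identityʳ k))) sk≡n))
  chunks {k} (suc l) 1≤k sk+l≡n = begin
      mapMaybe γ (range (k * R) (R + suc l * R))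
    ≡⟨ cong (mapMaybe γ) (range-++ (k * R) R (suc l * R)) ⟩
      mapMaybe γ (range (k * R) R ++ range (k * R + R) (suc l * R))
    ≡⟨ mapMaybe-++ γ (range (k * R) R) (range (k * R + R) (suc l * R)) ⟩
      mapMaybe γ (range (k * R) R) ++ mapMaybe γ (range (k * R + R) (suc l * R))
    ≡⟨ cong₂ _++_ (chunk 1≤k sk<n) (trans (cong (λ x → mapMaybe γ (range x (suc l * R))) (+-comm (k * R) R))
                                          (chunks l z<s (trans (cong suc (sym (+-suc k l))) sk+l≡n))) ⟩
      diagonal p q k ∷ offDiagonal k ∷ crossingsFrom (suc k) l
    ∎
    where
      open ≡-Reasoning
      sk<n : suc k < n
      sk<n = subst (suc (suc k) ≤_) sk+l≡n (s≤s (subst (suc k ≤_) (sym (+-suc k l)) (s≤s (m≤m+n k l))))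

  crossings≡ : ∀ l → suc (suc l) ≡ n → crossings p q ≡ crossingsFrom 1 l
  crossings≡ l ssl≡n = begin
      mapMaybe γ (map suc (upTo (R * n ∸ 1)))
    ≡⟨ cong (mapMaybe γ) (map-suc-upTo (R * n ∸ 1)) ⟩
      mapMaybe γ (range 1 (R * n ∸ 1))
    ≡⟨ cong (mapMaybe γ ∘ range 1) duration ⟩
      mapMaybe γ (range 1 ((R ∸ 1) + suc l * R))
    ≡⟨ cong (mapMaybe γ) (range-++ 1 (R ∸ 1) (suc l * R)) ⟩
      mapMaybe γ (range 1 (R ∸ 1) ++ range (1 + (R ∸ 1)) (suc l * R))
    ≡⟨ mapMaybe-++ γ (range 1 (R ∸ 1)) (range (1 + (R ∸ 1)) (suc l * R)) ⟩
      mapMaybe γ (range 1 (R ∸ 1)) ++ mapMaybe γ (range (1 + (R ∸ 1)) (suc l * R))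
    ≡⟨ cong₂ _++_ before-first (trans (cong (λ x → mapMaybe γ (range x (suc l * R))) (trans (m+[n∸m]≡n 1≤R) (sym (*-identityˡ R))))
                                      (chunks l ≤-refl ssl≡n)) ⟩
      crossingsFrom 1 l
    ∎
    where
      open ≡-Reasoning
      duration : R * n ∸ 1 ≡ (R ∸ 1) + suc l * R
      duration = trans (cong (_∸ 1) (trans (cong (R *_) (sym ssl≡n)) (trans (*-suc R (suc l)) (cong (R +_) (*-comm R (suc l))))))
                       (+-∸-comm (suc l * R) 1≤R)
      R<pn : R < p * n
      R<pn = *-monoʳ-< p (m<n+m q (>-nonZero⁻¹ p))
      R<qn : R < q * n
      R<qn = subst (_< q * n) (sym R≡q*p) (*-monoʳ-< q (m<m+n p (>-nonZero⁻¹ q)))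
      before-first : mapMaybe γ (range 1 (R ∸ 1)) ≡ []
      before-first = mapMaybe-range-nothing γ 1 (R ∸ 1) λ T 1≤T T<1+[R∸1] →
        let T<R = subst (T <_) (m+[n∸m]≡n 1≤R) T<1+[R∸1] in crossingAt-nothing
          (>⇒∤ {{>-nonZero 1≤T}} (<-trans T<R R<pn)) (>⇒∤ {{>-nonZero 1≤T}} (<-trans T<R R<qn)) (>⇒∤ {{>-nonZero 1≤T}} T<R)

  diagonalSign offDiagonalSign : Sign → ℕ → Sign
  diagonalSign s k    = crossSign s (diagonal p q k)
  offDiagonalSign s k = crossSign s (offDiagonal k)

  block : Sign → ℕ → List Sign
  block s k = diagonalSign s k ∷ jointSign (diagonal p q k) (offDiagonal k)
            ∷ offDiagonalSign s k ∷ jointSign (offDiagonal k) (diagonal p q (suc k)) ∷ []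

  diagonal-rightEnd : ∀ k → rightEnd (diagonal p q k) ≡ (suc (a k) , k ∸ suc (a k))
  diagonal-rightEnd k = trans (cong (λ x → suc x , k ∸ x ∸ 1) (/'≡/ (q * k) n))
    (cong (suc (a k) ,_) (trans (∸-+-assoc k (a k) 1) (cong (k ∸_) (+-comm (a k) 1))))

  vertical-rightEnd : ∀ c → rightEnd (vertical p q c) ≡ (c , p * c / q)
  vertical-rightEnd c = cong (c ,_) (/'≡/ (p * c) q)

  horizontal-rightEnd : ∀ j → rightEnd (horizontal p q j) ≡ (suc (q * j / p) , j)
  horizontal-rightEnd j = cong (λ x → suc x , j) (/'≡/ (q * j) p)

  joint-before-vertical : ∀ {k} → 1 ≤ k → p < r k → jointSign (diagonal p q k) (offDiagonal k) ≡ minus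
  joint-before-vertical {k} 1≤k p<rk = trans (cong (jointSign (diagonal p q k)) (offDiagonal-vertical (<⇒≤ p<rk)))
    (jointSign-meet (diagonal p q k) (vertical p q (suc (a k))) (begin
      rightEnd (diagonal p q k)            ≡⟨ diagonal-rightEnd k ⟩
      (suc (a k) , k ∸ suc (a k))          ≡⟨ cong (suc (a k) ,_) (sym (proj₁ (vertical-divMod 1≤k p<rk (m+[n∸m]≡n (<⇒≤ (r<n k)))))) ⟩
      (suc (a k) , p * suc (a k) / q)      ≡⟨ sym (vertical-rightEnd (suc (a k))) ⟩
      rightEnd (vertical p q (suc (a k)))  ∎))
    where open ≡-Reasoning

  joint-after-vertical : ∀ {k} → p ≤ r k → jointSign (offDiagonal k) (diagonal p q (suc k)) ≡ plus
  joint-after-vertical {k} p≤rk =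
    trans (cong (λ σ → jointSign σ (diagonal p q (suc k))) (offDiagonal-vertical p≤rk))
          (jointSign-apart₁ (vertical p q (suc (a k))) (diagonal p q (suc k)) λ eq →
             <-irrefl (trans eq (trans (cong proj₁ (diagonal-rightEnd (suc k))) (cong suc (proj₁ (r-step-vertical k p≤rk)))))
                      (n<1+n (suc (a k))))

  joint-before-horizontal : ∀ {k} → 1 ≤ k → r k < p → jointSign (diagonal p q k) (offDiagonal k) ≡ plus
  joint-before-horizontal {k} 1≤k rk<p =
    trans (cong (jointSign (diagonal p q k)) (offDiagonal-horizontal rk<p))
          (jointSign-apart₂ (diagonal p q k) (horizontal p q (k ∸ a k)) λ eq →
             <-irrefl (trans (sym (cong proj₂ (diagonal-rightEnd k))) (trans eq (+-∸-assoc 1 (a<k 1≤k))))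
                      (n<1+n (k ∸ suc (a k))))

  joint-after-horizontal : ∀ {k} → 1 ≤ k → r k < p → jointSign (offDiagonal k) (diagonal p q (suc k)) ≡ minus
  joint-after-horizontal {k} 1≤k rk<p = trans (cong (λ σ → jointSign σ (diagonal p q (suc k))) (offDiagonal-horizontal rk<p))
    (jointSign-meet (horizontal p q (k ∸ a k)) (diagonal p q (suc k)) (begin
      rightEnd (horizontal p q (k ∸ a k))          ≡⟨ horizontal-rightEnd (k ∸ a k) ⟩
      (suc (q * (k ∸ a k) / p) , k ∸ a k)          ≡⟨ cong (λ x → suc x , k ∸ a k) (proj₁ (horizontal-divMod 1≤k rk<p)) ⟩
      (suc (a k) , suc k ∸ suc (a k))              ≡⟨ cong (λ x → suc x , suc k ∸ suc x) (sym (proj₁ (r-step-horizontal k rk<p))) ⟩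
      (suc (a (suc k)) , suc k ∸ suc (a (suc k)))  ≡⟨ sym (diagonal-rightEnd (suc k)) ⟩
      rightEnd (diagonal p q (suc k))              ∎))
    where open ≡-Reasoning

  near-diagonal : ∀ {k ρ} → r k ≡ ρ → near (diagonal p q k) ≡ nearFrom false ρ n
  near-diagonal {k} rk≡ρ = cong (λ x → nearFrom false x n) (trans (%'≡% (q * k) n) rk≡ρ)

  near-vertical : ∀ {k ρ} σ → 1 ≤ k → r k ≡ ρ → p < ρ → ρ + σ ≡ p + q → near (offDiagonal k) ≡ nearFrom true σ q
  near-vertical {k} σ 1≤k refl p<rk rk+σ≡n = trans (cong near (offDiagonal-vertical (<⇒≤ p<rk)))
    (cong (λ x → nearFrom true x q) (trans (%'≡% (p * suc (a k)) q) (proj₂ (vertical-divMod 1≤k p<rk rk+σ≡n))))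

  near-horizontal : ∀ {k ρ} → 1 ≤ k → r k ≡ ρ → ρ < p → near (offDiagonal k) ≡ nearFrom false ρ p
  near-horizontal {k} 1≤k refl rk<p = trans (cong near (offDiagonal-horizontal rk<p))
    (cong (λ x → nearFrom false x p) (trans (%'≡% (q * (k ∸ a k)) p) (proj₂ (horizontal-divMod 1≤k rk<p))))

  diagonal-nearLeft : ∀ s k {ρ} → r k ≡ ρ → 2 * ρ < p + q → diagonalSign s k ≡ plus
  diagonal-nearLeft s k {ρ} rk≡ρ lt = crossSign-near s (diagonal p q k) (trans (near-diagonal rk≡ρ) (nearFrom-below false ρ n lt))

  diagonal-nearRight : ∀ s k {ρ} → r k ≡ ρ → p + q < 2 * ρ → diagonalSign s k ≡ minus
  diagonal-nearRight s k {ρ} rk≡ρ gt = crossSign-near s (diagonal p q k) (trans (near-diagonal rk≡ρ) (nearFrom-above false ρ n gt))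

  diagonal-midpoint : ∀ s k {ρ} → r k ≡ ρ → 2 * ρ ≡ p + q → diagonalSign s k ≡ s
  diagonal-midpoint s k {ρ} rk≡ρ eq = crossSign-near s (diagonal p q k) (trans (near-diagonal rk≡ρ) (nearFrom-middle false ρ n eq))

  vertical-nearRight : ∀ s {k ρ} σ → r (suc k) ≡ ρ → p < ρ → ρ + σ ≡ p + q → 2 * σ < q → offDiagonalSign s (suc k) ≡ minus
  vertical-nearRight s {k} σ rk≡ρ p<ρ ρ+σ≡n lt = crossSign-near s (offDiagonal (suc k)) (trans (near-vertical σ z<s rk≡ρ p<ρ ρ+σ≡n) (nearFrom-below true σ q lt))

  vertical-nearLeft : ∀ s {k ρ} σ → r (suc k) ≡ ρ → p < ρ → ρ + σ ≡ p + q → q < 2 * σ → offDiagonalSign s (suc k) ≡ plus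
  vertical-nearLeft s {k} σ rk≡ρ p<ρ ρ+σ≡n gt = crossSign-near s (offDiagonal (suc k)) (trans (near-vertical σ z<s rk≡ρ p<ρ ρ+σ≡n) (nearFrom-above true σ q gt))

  vertical-midpoint : ∀ s {k ρ} σ → r (suc k) ≡ ρ → p < ρ → ρ + σ ≡ p + q → 2 * σ ≡ q → offDiagonalSign s (suc k) ≡ s
  vertical-midpoint s {k} σ rk≡ρ p<ρ ρ+σ≡n eq = crossSign-near s (offDiagonal (suc k)) (trans (near-vertical σ z<s rk≡ρ p<ρ ρ+σ≡n) (nearFrom-middle true σ q eq))

  horizontal-nearLeft : ∀ s {k ρ} → r (suc k) ≡ ρ → ρ < p → 2 * ρ < p → offDiagonalSign s (suc k) ≡ plus
  horizontal-nearLeft s {k} {ρ} rk≡ρ ρ<p lt = crossSign-near s (offDiagonal (suc k)) (trans (near-horizontal z<s rk≡ρ ρ<p) (nearFrom-below false ρ p lt))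

  horizontal-nearRight : ∀ s {k ρ} → r (suc k) ≡ ρ → ρ < p → p < 2 * ρ → offDiagonalSign s (suc k) ≡ minus
  horizontal-nearRight s {k} {ρ} rk≡ρ ρ<p gt = crossSign-near s (offDiagonal (suc k)) (trans (near-horizontal z<s rk≡ρ ρ<p) (nearFrom-above false ρ p gt))

  horizontal-midpoint : ∀ s {k ρ} → r (suc k) ≡ ρ → ρ < p → 2 * ρ ≡ p → offDiagonalSign s (suc k) ≡ s
  horizontal-midpoint s {k} {ρ} rk≡ρ ρ<p eq = crossSign-near s (offDiagonal (suc k)) (trans (near-horizontal z<s rk≡ρ ρ<p) (nearFrom-middle false ρ p eq))

  diagonal-before-horizontal : ∀ s k {ρ} → r k ≡ ρ → ρ < p → diagonalSign s k ≡ plus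
  diagonal-before-horizontal s k rk≡ρ ρ<p = diagonal-nearLeft s k rk≡ρ (<-trans (*-monoʳ-< 2 ρ<p) 2p<n)

  diagonal-after-horizontal : ∀ s k {ρ} → r k ≡ ρ → ρ < p → diagonalSign s (suc k) ≡ minus
  diagonal-after-horizontal s k refl rk<p =
    diagonal-nearRight s (suc k) (proj₂ (r-step-horizontal k rk<p)) (<-≤-trans n<2q (*-monoʳ-≤ 2 (m≤n+m q (r k))))

  block-vertical : ∀ {s k ρ d e} → r (suc k) ≡ ρ → p < ρ → diagonalSign s (suc k) ≡ d → offDiagonalSign s (suc k) ≡ e →
                   block s (suc k) ≡ d ∷ minus ∷ e ∷ plus ∷ []
  block-vertical refl p<rk d≡ e≡ = cong₂ _∷_ d≡ (cong₂ _∷_ (joint-before-vertical z<s p<rk)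
    (cong₂ _∷_ e≡ (cong (_∷ []) (joint-after-vertical (<⇒≤ p<rk)))))

  block-horizontal : ∀ {s k ρ e} → r (suc k) ≡ ρ → ρ < p → offDiagonalSign s (suc k) ≡ e →
                     block s (suc k) ≡ plus ∷ plus ∷ e ∷ minus ∷ []
  block-horizontal {s} {k} refl rk<p e≡ =
    cong₂ _∷_ (diagonal-before-horizontal s (suc k) refl rk<p) (cong₂ _∷_ (joint-before-horizontal z<s rk<p)
      (cong₂ _∷_ e≡ (cong (_∷ []) (joint-after-horizontal z<s rk<p))))

  -- Counting sign changes

  BlockChanges : Sign → ℕ → Sign → Set
  BlockChanges s k ℓ = changesFrom ℓ (block s (suc k) ++ diagonalSign s (suc (suc k)) ∷ minus ∷ []) + 2 * a (suc k)
                     ≡ changesFrom ℓ (diagonalSign s (suc k) ∷ minus ∷ []) + 2 * a (suc (suc k))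

  vertical-block-changes : ∀ s k ℓ → p < r (suc k) → BlockChanges s k ℓ
  vertical-block-changes s k ℓ p<r = begin
      changesFrom ℓ (block s (suc k) ++ d′ ∷ minus ∷ []) + 2 * a (suc k)
    ≡⟨ cong (λ B → changesFrom ℓ (B ++ d′ ∷ minus ∷ []) + 2 * a (suc k)) (block-vertical refl p<r refl refl) ⟩
      changesFrom ℓ (d ∷ minus ∷ e ∷ plus ∷ d′ ∷ minus ∷ []) + 2 * a (suc k)
    ≡⟨ cong (_+ 2 * a (suc k)) (changes-vertical-block ℓ d e d′) ⟩
      changesFrom ℓ (d ∷ minus ∷ []) + 2 + 2 * a (suc k)
    ≡⟨ regroup (changesFrom ℓ (d ∷ minus ∷ [])) (a (suc k)) ⟩
      changesFrom ℓ (d ∷ minus ∷ []) + 2 * suc (a (suc k))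
    ≡⟨ cong (λ x → changesFrom ℓ (d ∷ minus ∷ []) + 2 * x) (sym (proj₁ (r-step-vertical (suc k) (<⇒≤ p<r)))) ⟩
      changesFrom ℓ (d ∷ minus ∷ []) + 2 * a (suc (suc k))
    ∎
    where
      open ≡-Reasoning
      d e d′ : Sign
      d  = diagonalSign s (suc k)
      e  = offDiagonalSign s (suc k)
      d′ = diagonalSign s (suc (suc k))
      regroup : ∀ x y → x + 2 + 2 * y ≡ x + 2 * suc y
      regroup = solve-∀

  horizontal-block-changes : ∀ s k ℓ → r (suc k) < p → BlockChanges s k ℓ
  horizontal-block-changes s k ℓ r<p = begin
      changesFrom ℓ (block s (suc k) ++ diagonalSign s (suc (suc k)) ∷ minus ∷ []) + 2 * a (suc k)
    ≡⟨ cong₂ (λ B x → changesFrom ℓ (B ++ x ∷ minus ∷ []) + 2 * a (suc k))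
             (block-horizontal refl r<p refl) (diagonal-after-horizontal s (suc k) refl r<p) ⟩
      changesFrom ℓ (plus ∷ plus ∷ e ∷ minus ∷ minus ∷ minus ∷ []) + 2 * a (suc k)
    ≡⟨ cong₂ (λ c x → c + 2 * x) (changes-horizontal-block ℓ e) (sym (proj₁ (r-step-horizontal (suc k) r<p))) ⟩
      changesFrom ℓ (plus ∷ minus ∷ []) + 2 * a (suc (suc k))
    ≡⟨ cong (λ x → changesFrom ℓ (x ∷ minus ∷ []) + 2 * a (suc (suc k))) (sym (diagonal-before-horizontal s (suc k) refl r<p)) ⟩
      changesFrom ℓ (diagonalSign s (suc k) ∷ minus ∷ []) + 2 * a (suc (suc k))
    ∎
    where
      open ≡-Reasoning
      e : Sign
      e = offDiagonalSign s (suc k)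

  block-changes : ∀ s k ℓ → suc (suc k) < n → BlockChanges s k ℓ
  block-changes s k ℓ ssk<n with p ≤? r (suc k)
  ... | yes p≤r = vertical-block-changes s k ℓ (≤∧≢⇒< p≤r (r≢p ssk<n ∘ sym))
  ... | no  p≰r = horizontal-block-changes s k ℓ (≰⇒> p≰r)

  prefix : Sign → ℕ → List Sign
  prefix s zero    = []
  prefix s (suc m) = prefix s m ++ block s (suc m)

  -- The virtual minus after the diagonal sign makes the count independent of that sign;
  -- each vertical crossing then contributes exactly two changes.
  changes-to-diagonal : ∀ s m → suc m < n →
    changesFrom minus (prefix s m ++ diagonalSign s (suc m) ∷ minus ∷ []) ≡ 2 * a (suc m)
  changes-to-diagonal s zero _ =
    trans (cong (λ d → changesFrom minus (d ∷ minus ∷ [])) (diagonal-nearRight s 1 (proj₂ at-1) n<2q))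
          (cong (2 *_) (sym (proj₁ at-1)))
    where
      at-1 : a 1 ≡ 0 × r 1 ≡ q
      at-1 = divMod-qk 1 0 q (trans (*-identityʳ q) (sym (+-identityʳ q))) (m<n+m q (>-nonZero⁻¹ p))
  changes-to-diagonal s (suc m) ssm<n = +-cancelʳ-≡ (2 * a (suc m)) _ _ (begin
      changesFrom minus (prefix s (suc m) ++ d′ ∷ minus ∷ []) + 2 * a (suc m)
    ≡⟨ cong (λ xs → changesFrom minus xs + 2 * a (suc m)) (++-assoc (prefix s m) (block s (suc m)) (d′ ∷ minus ∷ [])) ⟩
      changesFrom minus (prefix s m ++ block s (suc m) ++ d′ ∷ minus ∷ []) + 2 * a (suc m)
    ≡⟨ cong (_+ 2 * a (suc m)) (changesFrom-++ minus (prefix s m) (block s (suc m) ++ d′ ∷ minus ∷ [])) ⟩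
      c + changesFrom ℓ (block s (suc m) ++ d′ ∷ minus ∷ []) + 2 * a (suc m)
    ≡⟨ +-assoc c _ _ ⟩
      c + (changesFrom ℓ (block s (suc m) ++ d′ ∷ minus ∷ []) + 2 * a (suc m))
    ≡⟨ cong (c +_) (block-changes s m ℓ ssm<n) ⟩
      c + (changesFrom ℓ (d ∷ minus ∷ []) + 2 * a (suc (suc m)))
    ≡⟨ sym (+-assoc c _ _) ⟩
      c + changesFrom ℓ (d ∷ minus ∷ []) + 2 * a (suc (suc m))
    ≡⟨ cong (_+ 2 * a (suc (suc m))) (sym (changesFrom-++ minus (prefix s m) (d ∷ minus ∷ []))) ⟩
      changesFrom minus (prefix s m ++ d ∷ minus ∷ []) + 2 * a (suc (suc m))
    ≡⟨ cong (_+ 2 * a (suc (suc m))) (changes-to-diagonal s m (<-trans (n<1+n (suc m)) ssm<n)) ⟩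
      2 * a (suc m) + 2 * a (suc (suc m))
    ≡⟨ +-comm (2 * a (suc m)) _ ⟩
      2 * a (suc (suc m)) + 2 * a (suc m)
    ∎)
    where
      open ≡-Reasoning
      c : ℕ
      c = changesFrom minus (prefix s m)
      ℓ d d′ : Sign
      ℓ  = lastFrom minus (prefix s m)
      d  = diagonalSign s (suc m)
      d′ = diagonalSign s (suc (suc m))

  signs-prefix : ∀ s m l → signsFrom s (crossingsFrom 1 (m + l)) ≡ prefix s m ++ signsFrom s (crossingsFrom (suc m) l)
  signs-prefix s zero    l = refl
  signs-prefix s (suc m) l = begin
      signsFrom s (crossingsFrom 1 (suc m + l))
    ≡⟨ cong (signsFrom s ∘ crossingsFrom 1) (sym (+-suc m l)) ⟩
      signsFrom s (crossingsFrom 1 (m + suc l))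
    ≡⟨ signs-prefix s m (suc l) ⟩
      prefix s m ++ block s (suc m) ++ signsFrom s (crossingsFrom (suc (suc m)) l)
    ≡⟨ sym (++-assoc (prefix s m) (block s (suc m)) _) ⟩
      prefix s (suc m) ++ signsFrom s (crossingsFrom (suc (suc m)) l)
    ∎
    where open ≡-Reasoning

  signs-split : ∀ s m l → suc (suc (m + l)) ≡ p + q →
                signsFrom s (crossings p q) ≡ prefix s m ++ signsFrom s (crossingsFrom (suc m) l)
  signs-split s m l ssml≡n = trans (cong (signsFrom s) (crossings≡ (m + l) ssml≡n)) (signs-prefix s m l)

  changes-past-diagonal : ∀ s m ys → suc m < n →
    changesFrom minus (prefix s m ++ diagonalSign s (suc m) ∷ minus ∷ ys) ≡ 2 * a (suc m) + changesFrom minus ys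
  changes-past-diagonal s m ys sm<n = begin
      changesFrom minus (prefix s m ++ d ∷ minus ∷ ys)
    ≡⟨ cong (changesFrom minus) (sym (++-assoc (prefix s m) (d ∷ minus ∷ []) ys)) ⟩
      changesFrom minus ((prefix s m ++ d ∷ minus ∷ []) ++ ys)
    ≡⟨ changesFrom-++ minus (prefix s m ++ d ∷ minus ∷ []) ys ⟩
      changesFrom minus (prefix s m ++ d ∷ minus ∷ []) + changesFrom (lastFrom minus (prefix s m ++ d ∷ minus ∷ [])) ys
    ≡⟨ cong₂ _+_ (changes-to-diagonal s m sm<n) (cong (λ ℓ → changesFrom ℓ ys) (lastFrom-++ minus (prefix s m) (d ∷ minus ∷ []))) ⟩
      2 * a (suc m) + changesFrom minus ys
    ∎
    where
      open ≡-Reasoning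
      d : Sign
      d = diagonalSign s (suc m)

  middle-runs : ∀ s m l ys c {A} i x {rest} → suc (suc (m + l)) ≡ p + q →
    signsFrom s (crossingsFrom (suc m) l)
      ≡ diagonalSign s (suc m) ∷ minus ∷ ys ++ replicate (suc i) x ++ s ∷ replicate (suc i) (opposite x) ++ x ∷ rest →
    lastFrom minus ys ≢ x → changesFrom minus ys ≡ c → a (suc m) ≡ A → q ≡ 3 + 2 * A + c →
    FirstTwoAre (suc i) (suc (suc i)) (drop (q ∸ 2) (C[ p / q ] s))
  middle-runs s m l ys c {A} i x {rest} ssml≡n window ys≢x ys-changes a≡A q≡ =
    subst (FirstTwoAre (suc i) (suc (suc i))) (sym drop≡) (runs-around i x s rest)
    where
      open ≡-Reasoning
      D P W : List Sign
      D = diagonalSign s (suc m) ∷ minus ∷ ys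
      P = prefix s m ++ D
      W = replicate i x ++ s ∷ replicate (suc i) (opposite x) ++ x ∷ rest
      sm<n : suc m < n
      sm<n = subst (suc (suc m) ≤_) ssml≡n (s≤s (s≤s (m≤m+n m l)))
      changes≡ : changesFrom minus P ≡ 2 * A + c
      changes≡ = trans (changes-past-diagonal s m ys sm<n) (cong₂ (λ A′ c′ → 2 * A′ + c′) a≡A ys-changes)
      drop≡ : drop (q ∸ 2) (C[ p / q ] s) ≡ runs (x ∷ W)
      drop≡ = begin
        drop (q ∸ 2) (runs (minus ∷ signsFrom s (crossings p q)))
          ≡⟨ cong₂ (λ j zs → drop j (runs (minus ∷ zs))) (cong (_∸ 2) q≡)
                   (trans (signs-split s m l ssml≡n) (cong (prefix s m ++_) window)) ⟩
        drop (suc (2 * A + c)) (runs (minus ∷ prefix s m ++ D ++ x ∷ W))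
          ≡⟨ cong₂ (λ j zs → drop (suc j) (runs (minus ∷ zs))) (sym changes≡) (sym (++-assoc (prefix s m) D (x ∷ W))) ⟩
        drop (suc (changesFrom minus P)) (runs (minus ∷ P ++ x ∷ W))
          ≡⟨ drop-runs minus P x W (ys≢x ∘ trans (sym (lastFrom-++ minus (prefix s m) D))) ⟩
        runs (x ∷ W)
          ∎

-- The four parity cases

MiddleRuns : ℕ → ℕ → ℕ → ℕ → Set
MiddleRuns p q i j = ∀ s → FirstTwoAre i j (drop (q ∸ 2) (C[ p / q ] s))

-- The middle crossing is on the diagonal x + y = k₂, where k₂ = 2u + t + 2 = n/2.
module OddOdd (u t : ℕ) (coprime : Coprime (suc (2 * u)) (suc (2 * u + 2 * t + 2))) where
  open Crossings (suc (2 * u)) (suc (2 * u + 2 * t + 2)) (m+o≡n⇒m≤n (2 * t + 1) (solve (u ∷ t ∷ []))) coprime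

  at-k₁ : a (suc (2 * u + t)) ≡ u + t × r (suc (2 * u + t)) ≡ 4 * u + t + 3
  at-k₁ = divMod-qk (suc (2 * u + t)) (u + t) (4 * u + t + 3) (solve (u ∷ t ∷ [])) (m+o≡n⇒m≤n t (solve (u ∷ t ∷ [])))

  at-k₂ : a (suc (suc (2 * u + t))) ≡ u + t + 1 × r (suc (suc (2 * u + t))) ≡ 2 * u + t + 2
  at-k₂ = divMod-qk (suc (suc (2 * u + t))) (u + t + 1) (2 * u + t + 2) (solve (u ∷ t ∷ [])) (m+o≡n⇒m≤n (2 * u + t + 1) (solve (u ∷ t ∷ [])))

  p<r₁ : suc (2 * u) < 4 * u + t + 3
  p<r₁ = m+o≡n⇒m≤n (2 * u + t + 1) (solve (u ∷ t ∷ []))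

  p<r₂ : suc (2 * u) < 2 * u + t + 2
  p<r₂ = m+o≡n⇒m≤n t (solve (u ∷ t ∷ []))

  middle : MiddleRuns (suc (2 * u)) (suc (2 * u + 2 * t + 2)) 1 2
  middle s = middle-runs s (2 * u + t) (2 + (2 * u + t)) (minus ∷ []) 0 0 plus (solve (u ∷ t ∷ []))
    (cong₂ _++_
      (block-vertical (proj₂ at-k₁) p<r₁ refl
        (vertical-nearRight s (t + 1) (proj₂ at-k₁) p<r₁ (solve (u ∷ t ∷ [])) (m+o≡n⇒m≤n (2 * u) (solve (u ∷ t ∷ [])))))
      (cong₂ _++_
        (block-vertical (proj₂ at-k₂) p<r₂ (diagonal-midpoint s (suc (suc (2 * u + t))) (proj₂ at-k₂) (solve (u ∷ t ∷ [])))
          (vertical-nearLeft s (2 * u + t + 2) (proj₂ at-k₂) p<r₂ (solve (u ∷ t ∷ [])) (m+o≡n⇒m≤n (2 * u) (solve (u ∷ t ∷ [])))))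
        refl))
    (λ ()) refl (proj₁ at-k₁) (solve (u ∷ t ∷ []))

-- The middle crossing is on the horizontal line y = u + 1 = p/2, between the diagonals k₂ and k₂ + 1.
module EvenOdd (u t : ℕ) (coprime : Coprime (suc (2 * u + 1)) (suc (2 * u + 2 * t + 2))) where
  open Crossings (suc (2 * u + 1)) (suc (2 * u + 2 * t + 2)) (m+o≡n⇒m≤n (2 * t) (solve (u ∷ t ∷ []))) coprime

  at-k₁ : a (suc (2 * u + t)) ≡ u + t × r (suc (2 * u + t)) ≡ 3 * u + 3
  at-k₁ = divMod-qk (suc (2 * u + t)) (u + t) (3 * u + 3) (solve (u ∷ t ∷ [])) (m+o≡n⇒m≤n (u + 2 * t + 1) (solve (u ∷ t ∷ [])))

  at-k₂ : a (suc (suc (2 * u + t))) ≡ u + t + 1 × r (suc (suc (2 * u + t))) ≡ u + 1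
  at-k₂ = divMod-qk (suc (suc (2 * u + t))) (u + t + 1) (u + 1) (solve (u ∷ t ∷ [])) (m+o≡n⇒m≤n (3 * u + 2 * t + 3) (solve (u ∷ t ∷ [])))

  at-k₃ : a (suc (suc (suc (2 * u + t)))) ≡ u + t + 1 × r (suc (suc (suc (2 * u + t)))) ≡ 3 * u + 2 * t + 4
  at-k₃ = divMod-qk (suc (suc (suc (2 * u + t)))) (u + t + 1) (3 * u + 2 * t + 4) (solve (u ∷ t ∷ [])) (m+o≡n⇒m≤n u (solve (u ∷ t ∷ [])))

  p<r₁ : suc (2 * u + 1) < 3 * u + 3
  p<r₁ = m+o≡n⇒m≤n u (solve (u ∷ t ∷ []))

  r₂<p : u + 1 < suc (2 * u + 1)
  r₂<p = m+o≡n⇒m≤n u (solve (u ∷ t ∷ []))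

  p<r₃ : suc (2 * u + 1) < 3 * u + 2 * t + 4
  p<r₃ = m+o≡n⇒m≤n (u + 2 * t + 1) (solve (u ∷ t ∷ []))

  middle : MiddleRuns (suc (2 * u + 1)) (suc (2 * u + 2 * t + 2)) 4 5
  middle s = middle-runs s (2 * u + t) (3 + (2 * u + t)) [] 0 3 plus (solve (u ∷ t ∷ []))
    (cong₂ _++_
      (block-vertical (proj₂ at-k₁) p<r₁ refl
        (vertical-nearLeft s (u + 2 * t + 2) (proj₂ at-k₁) p<r₁ (solve (u ∷ t ∷ [])) (m+o≡n⇒m≤n (2 * t) (solve (u ∷ t ∷ [])))))
      (cong₂ _++_
        (block-horizontal (proj₂ at-k₂) r₂<p (horizontal-midpoint s (proj₂ at-k₂) r₂<p (solve (u ∷ t ∷ []))))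
        (cong₂ _++_
          (block-vertical (proj₂ at-k₃) p<r₃ (diagonal-after-horizontal s (suc (suc (2 * u + t))) (proj₂ at-k₂) r₂<p)
            (vertical-nearRight s (u + 1) (proj₂ at-k₃) p<r₃ (solve (u ∷ t ∷ [])) (m+o≡n⇒m≤n (2 * t) (solve (u ∷ t ∷ [])))))
          refl)))
    (λ ()) refl (proj₁ at-k₁) (solve (u ∷ t ∷ []))

-- The middle crossing is on the vertical line x = 2u + t + 2 = q/2, between the diagonals k₁ and k₁ + 1.
module OddEvenSmall (u t : ℕ) (coprime : Coprime (suc (2 * u)) (suc (4 * u + 2 * t + 3))) where
  open Crossings (suc (2 * u)) (suc (4 * u + 2 * t + 3)) (m+o≡n⇒m≤n (2 * u + 2 * t + 2) (solve (u ∷ t ∷ []))) coprime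

  at-k₀ : a (suc (3 * u + t)) ≡ 2 * u + t × r (suc (3 * u + t)) ≡ 6 * u + t + 4
  at-k₀ = divMod-qk (suc (3 * u + t)) (2 * u + t) (6 * u + t + 4) (solve (u ∷ t ∷ [])) (m+o≡n⇒m≤n t (solve (u ∷ t ∷ [])))

  at-k₁ : a (suc (suc (3 * u + t))) ≡ 2 * u + t + 1 × r (suc (suc (3 * u + t))) ≡ 4 * u + t + 3
  at-k₁ = divMod-qk (suc (suc (3 * u + t))) (2 * u + t + 1) (4 * u + t + 3) (solve (u ∷ t ∷ [])) (m+o≡n⇒m≤n (2 * u + t + 1) (solve (u ∷ t ∷ [])))

  at-k₂ : a (suc (suc (suc (3 * u + t)))) ≡ 2 * u + t + 2 × r (suc (suc (suc (3 * u + t)))) ≡ 2 * u + t + 2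
  at-k₂ = divMod-qk (suc (suc (suc (3 * u + t)))) (2 * u + t + 2) (2 * u + t + 2) (solve (u ∷ t ∷ [])) (m+o≡n⇒m≤n (4 * u + t + 2) (solve (u ∷ t ∷ [])))

  p<r₀ : suc (2 * u) < 6 * u + t + 4
  p<r₀ = m+o≡n⇒m≤n (4 * u + t + 2) (solve (u ∷ t ∷ []))

  p<r₁ : suc (2 * u) < 4 * u + t + 3
  p<r₁ = m+o≡n⇒m≤n (2 * u + t + 1) (solve (u ∷ t ∷ []))

  p<r₂ : suc (2 * u) < 2 * u + t + 2
  p<r₂ = m+o≡n⇒m≤n t (solve (u ∷ t ∷ []))

  middle : MiddleRuns (suc (2 * u)) (suc (4 * u + 2 * t + 3)) 2 3
  middle s = middle-runs s (3 * u + t) (3 + (3 * u + t)) (offDiagonalSign s (suc (3 * u + t)) ∷ plus ∷ []) 1 1 minus (solve (u ∷ t ∷ []))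
    (cong₂ _++_
      (block-vertical (proj₂ at-k₀) p<r₀ refl refl)
      (cong₂ _++_
        (block-vertical (proj₂ at-k₁) p<r₁ (diagonal-nearRight s (suc (suc (3 * u + t))) (proj₂ at-k₁) (m+o≡n⇒m≤n (2 * u) (solve (u ∷ t ∷ []))))
          (vertical-midpoint s (2 * u + t + 2) (proj₂ at-k₁) p<r₁ (solve (u ∷ t ∷ [])) (solve (u ∷ t ∷ []))))
        (cong₂ _++_
          (block-vertical (proj₂ at-k₂) p<r₂ (diagonal-nearLeft s (suc (suc (suc (3 * u + t)))) (proj₂ at-k₂) (m+o≡n⇒m≤n (2 * u) (solve (u ∷ t ∷ [])))) refl)
          refl)))
    (λ ()) (changesFrom-through {minus} {plus} (offDiagonalSign s (suc (3 * u + t))) [] (λ ())) (proj₁ at-k₀) (solve (u ∷ t ∷ []))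

-- The middle crossing is on the vertical line x = 2t + v + 2 = q/2, between the diagonals k₂ and k₂ + 1.
module OddEvenLarge (t v : ℕ) (coprime : Coprime (suc (2 * t + 2 * v + 2)) (suc (4 * t + 2 * v + 3))) where
  open Crossings (suc (2 * t + 2 * v + 2)) (suc (4 * t + 2 * v + 3)) (m+o≡n⇒m≤n (2 * t) (solve (t ∷ v ∷ []))) coprime

  at-k₀ : a (suc (3 * t + 2 * v)) ≡ 2 * t + v × r (suc (3 * t + 2 * v)) ≡ 2 * t + 3 * v + 4
  at-k₀ = divMod-qk (suc (3 * t + 2 * v)) (2 * t + v) (2 * t + 3 * v + 4) (solve (t ∷ v ∷ [])) (m+o≡n⇒m≤n (4 * t + v + 2) (solve (t ∷ v ∷ [])))

  at-k₁ : a (suc (suc (3 * t + 2 * v))) ≡ 2 * t + v + 1 × r (suc (suc (3 * t + 2 * v))) ≡ v + 1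
  at-k₁ = divMod-qk (suc (suc (3 * t + 2 * v))) (2 * t + v + 1) (v + 1) (solve (t ∷ v ∷ [])) (m+o≡n⇒m≤n (6 * t + 3 * v + 5) (solve (t ∷ v ∷ [])))

  at-k₂ : a (suc (suc (suc (3 * t + 2 * v)))) ≡ 2 * t + v + 1 × r (suc (suc (suc (3 * t + 2 * v)))) ≡ 4 * t + 3 * v + 5
  at-k₂ = divMod-qk (suc (suc (suc (3 * t + 2 * v)))) (2 * t + v + 1) (4 * t + 3 * v + 5) (solve (t ∷ v ∷ [])) (m+o≡n⇒m≤n (2 * t + v + 1) (solve (t ∷ v ∷ [])))

  at-k₃ : a (suc (suc (suc (suc (3 * t + 2 * v))))) ≡ 2 * t + v + 2 × r (suc (suc (suc (suc (3 * t + 2 * v))))) ≡ 2 * t + v + 2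
  at-k₃ = divMod-qk (suc (suc (suc (suc (3 * t + 2 * v))))) (2 * t + v + 2) (2 * t + v + 2) (solve (t ∷ v ∷ [])) (m+o≡n⇒m≤n (4 * t + 3 * v + 4) (solve (t ∷ v ∷ [])))

  p<r₀ : suc (2 * t + 2 * v + 2) < 2 * t + 3 * v + 4
  p<r₀ = m+o≡n⇒m≤n v (solve (t ∷ v ∷ []))

  r₁<p : v + 1 < suc (2 * t + 2 * v + 2)
  r₁<p = m+o≡n⇒m≤n (2 * t + v + 1) (solve (t ∷ v ∷ []))

  p<r₂ : suc (2 * t + 2 * v + 2) < 4 * t + 3 * v + 5
  p<r₂ = m+o≡n⇒m≤n (2 * t + v + 1) (solve (t ∷ v ∷ []))

  r₃<p : 2 * t + v + 2 < suc (2 * t + 2 * v + 2)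
  r₃<p = m+o≡n⇒m≤n v (solve (t ∷ v ∷ []))

  middle : MiddleRuns (suc (2 * t + 2 * v + 2)) (suc (4 * t + 2 * v + 3)) 3 4
  middle s = middle-runs s (3 * t + 2 * v) (4 + (3 * t + 2 * v + 1)) (offDiagonalSign s (suc (3 * t + 2 * v)) ∷ plus ∷ plus ∷ plus ∷ plus ∷ []) 1 2 minus (solve (t ∷ v ∷ []))
    (cong₂ _++_
      (block-vertical (proj₂ at-k₀) p<r₀ refl refl)
      (cong₂ _++_
        (block-horizontal (proj₂ at-k₁) r₁<p (horizontal-nearLeft s (proj₂ at-k₁) r₁<p (m+o≡n⇒m≤n (2 * t) (solve (t ∷ v ∷ [])))))
        (cong₂ _++_
          (block-vertical (proj₂ at-k₂) p<r₂ (diagonal-after-horizontal s (suc (suc (3 * t + 2 * v))) (proj₂ at-k₁) r₁<p)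
            (vertical-midpoint s (2 * t + v + 2) (proj₂ at-k₂) p<r₂ (solve (t ∷ v ∷ [])) (solve (t ∷ v ∷ []))))
          (cong₂ _++_
            (block-horizontal (proj₂ at-k₃) r₃<p (horizontal-nearRight s (proj₂ at-k₃) r₃<p (m+o≡n⇒m≤n (2 * t) (solve (t ∷ v ∷ [])))))
            refl))))
    (λ ()) (changesFrom-through {minus} {plus} (offDiagonalSign s (suc (3 * t + 2 * v))) (plus ∷ plus ∷ plus ∷ []) (λ ())) (proj₁ at-k₀) (solve (t ∷ v ∷ []))

¬2∣⇒odd : ∀ {x} → ¬ 2 ∣ x → ∃[ u ] x ≡ suc (2 * u)
¬2∣⇒odd {x} 2∤x with x % 2 | m≡m%n+[m/n]*n x 2 | m%n<n x 2
... | 0           | x≡ | _ = ⊥-elim (2∤x (divides (x / 2) x≡))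
... | 1           | x≡ | _ = x / 2 , trans x≡ (cong suc (*-comm (x / 2) 2))
... | suc (suc _) | _  | s≤s (s≤s ())

2∣⇒even : ∀ {x} → 2 ∣ x → ∃[ u ] x ≡ 2 * u
2∣⇒even (divides u refl) = u , *-comm u 2

odd-odd : ∀ {p q} → p < q → Coprime p q → ¬ 2 ∣ p → ¬ 2 ∣ q → MiddleRuns p q 1 2
odd-odd p<q coprime 2∤p 2∤q with ¬2∣⇒odd 2∤p | ¬2∣⇒odd 2∤q
... | u , refl | w , refl with m≤n⇒∃[o]m+o≡n (*-cancelˡ-< 2 u w (s≤s⁻¹ p<q))
... | t , refl = subst (λ Q → MiddleRuns (suc (2 * u)) Q 1 2) (sym q≡) (OddOdd.middle u t (subst (Coprime _) q≡ coprime))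
  where
    q≡ : suc (2 * (suc u + t)) ≡ suc (2 * u + 2 * t + 2)
    q≡ = solve (u ∷ t ∷ [])

even-odd : ∀ {p q} → 0 < p → p < q → Coprime p q → 2 ∣ p → ¬ 2 ∣ q → MiddleRuns p q 4 5
even-odd 0<p p<q coprime 2∣p 2∤q with 2∣⇒even 2∣p | ¬2∣⇒odd 2∤q
... | zero  , refl | _ = ⊥-elim (<-irrefl refl 0<p)
... | suc u , refl | w , refl with m≤n⇒∃[o]m+o≡n (*-cancelˡ-≤ {suc u} {w} 2 (s≤s⁻¹ p<q))
... | t , refl = subst₂ (λ P Q → MiddleRuns P Q 4 5) (sym p≡) (sym q≡) (EvenOdd.middle u t (subst₂ Coprime p≡ q≡ coprime))
  where
    p≡ : 2 * suc u ≡ suc (2 * u + 1)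
    p≡ = solve (u ∷ [])
    q≡ : suc (2 * (suc u + t)) ≡ suc (2 * u + 2 * t + 2)
    q≡ = solve (u ∷ t ∷ [])

odd-even-small : ∀ {p q} → Coprime p q → ¬ 2 ∣ p → 2 ∣ q → 2 * p < q → MiddleRuns p q 2 3
odd-even-small coprime 2∤p 2∣q 2p<q with ¬2∣⇒odd 2∤p | 2∣⇒even 2∣q
... | u , refl | w , refl with m≤n⇒∃[o]m+o≡n (*-cancelˡ-< 2 (suc (2 * u)) w 2p<q)
... | t , refl = subst (λ Q → MiddleRuns (suc (2 * u)) Q 2 3) (sym q≡) (OddEvenSmall.middle u t (subst (Coprime _) q≡ coprime))
  where
    q≡ : 2 * (suc (suc (2 * u)) + t) ≡ suc (4 * u + 2 * t + 3)
    q≡ = solve (u ∷ t ∷ [])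

odd-even-large : ∀ {p q} → p < q → Coprime p q → ¬ 2 ∣ p → 2 ∣ q → q < 2 * p → MiddleRuns p q 3 4
odd-even-large p<q coprime 2∤p 2∣q q<2p with ¬2∣⇒odd 2∤p | 2∣⇒even 2∣q
... | u , refl | w , refl with m≤n⇒∃[o]m+o≡n (*-cancelˡ-< 2 u w (<-trans (n<1+n (2 * u)) p<q))
... | t , refl with m≤n⇒∃[o]m+o≡n t<u
  where
    t<u : t < u
    t<u = +-cancelˡ-< u t u (subst (u + t <_) (cong (u +_) (+-identityʳ u))
                                   (s≤s⁻¹ (*-cancelˡ-< 2 (suc (u + t)) (suc (2 * u)) q<2p)))
... | v , refl = subst₂ (λ P Q → MiddleRuns P Q 3 4) (sym p≡) (sym q≡) (OddEvenLarge.middle t v (subst₂ Coprime p≡ q≡ coprime))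
  where
    p≡ : suc (2 * (suc t + v)) ≡ suc (2 * t + 2 * v + 2)
    p≡ = solve (t ∷ v ∷ [])
    q≡ : 2 * (suc (suc t + v) + t) ≡ suc (4 * t + 2 * v + 3)
    q≡ = solve (t ∷ v ∷ [])

lemma4p4 : (p q : ℕ) → 0 < p → p < q → gcd p q ≡ 1 → (s : Sign) →
    ((¬ 2 ∣ p) → (¬ 2 ∣ q) →
      ∃[ rest ] (drop (q ∸ 2) (C[ p / q ] s) ≡ 1 ∷ 2 ∷ rest ⊎ drop (q ∸ 2) (C[ p / q ] s) ≡ 2 ∷ 1 ∷ rest))
    × ((2 ∣ p) → (¬ 2 ∣ q) →
      ∃[ rest ] (drop (q ∸ 2) (C[ p / q ] s) ≡ 4 ∷ 5 ∷ rest ⊎ drop (q ∸ 2) (C[ p / q ] s) ≡ 5 ∷ 4 ∷ rest))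
    × ((¬ 2 ∣ p) → (2 ∣ q) → 2 * p < q →
      ∃[ rest ] (drop (q ∸ 2) (C[ p / q ] s) ≡ 2 ∷ 3 ∷ rest ⊎ drop (q ∸ 2) (C[ p / q ] s) ≡ 3 ∷ 2 ∷ rest))
    × ((¬ 2 ∣ p) → (2 ∣ q) → q < 2 * p →
      ∃[ rest ] (drop (q ∸ 2) (C[ p / q ] s) ≡ 3 ∷ 4 ∷ rest ⊎ drop (q ∸ 2) (C[ p / q ] s) ≡ 4 ∷ 3 ∷ rest))
lemma4p4 p q 0<p p<q gcd≡1 s =
    (λ 2∤p 2∤q → odd-odd p<q coprime 2∤p 2∤q s)
  , (λ 2∣p 2∤q → even-odd 0<p p<q coprime 2∣p 2∤q s)
  , (λ 2∤p 2∣q 2p<q → odd-even-small coprime 2∤p 2∣q 2p<q s)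
  , (λ 2∤p 2∣q q<2p → odd-even-large p<q coprime 2∤p 2∣q q<2p s)
  where
    coprime : Coprime p q
    coprime = gcd≡1⇒coprime gcd≡1
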